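{- Let $\mathbf{M}=(m_{ij})$ be a nonsingular $2\times 2$ integer matrix with $|\det\mathbf{M}|=m$, and let $\mathbf{e}_1=(1,0)^\top$, $\mathbf{e}_2=(0,1)^\top$. Then the digraph $G(\mathbf{M};\mathbf{e}_1,\mathbf{e}_2)$ is a circulant digraph if and only if either $d_1=\gcd(m_{11},m_{12},m_{21},m_{22})=1$, or $d_1=2$ and $m=2\gcd(m,\,m_{22}+m_{12},\,m_{11}+m_{21})$.
   Context: $G(\mathbf{M};\mathbf{e}_1,\mathbf{e}_2)$ is the digraph with vertex set $\mathbb{Z}^2/\mathbf{M}\mathbb{Z}^2$ (integer vectors modulo the lattice spanned by the columns of $\mathbf{M}$) and arcs $\mathbf{u}\to\mathbf{u}+\mathbf{e}_1$ and $\mathbf{u}\to\mathbf{u}+\mathbf{e}_2$ (mod $\mathbf{M}$). A circulant digraph is a digraph isomorphic to a Cayley digraph of a cyclic group $\mathbb{Z}/m'\mathbb{Z}$, i.e. vertex set $\mathbb{Z}/m'\mathbb{Z}$ with arcs $u\to u+b\bmod m'$ for $b$ in some set $B$. -}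

module Defs where

open import Data.Nat as ℕ using (ℕ; NonZero)
open import Data.Nat.GCD using (gcd)
open import Data.Integer as ℤ using (ℤ; +_; _+_; _-_; _*_; ∣_∣)
open import Data.Integer.Divisibility using (_∣_)
open import Data.Product using (Σ; ∃; ∃-syntax; _×_; _,_)
open import Data.Sum using (_⊎_)
open import Data.List using (List)
open import Data.List.Membership.Propositional using (_∈_)
open import Relation.Binary.PropositionalEquality using (_≡_)
open import Relation.Binary.Structures using (IsEquivalence)
open import Function.Bundles using (_⇔_)

-- Digraphs whose vertex set is given as a setoid (quotients are not
-- available, so Z^2 / M Z^2 and Z / m'Z are presented as setoids).
-- An arc relation is a (proof-relevant) relation on vertices.

record Digraph : Set₁ where
  field
    V     : Set
    _≈_   : V → V → Set
    Arc   : V → V → Set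

record _≅_ (G H : Digraph) : Set where
  module G = Digraph G
  module H = Digraph H
  field
    to       : G.V → H.V
    from     : H.V → G.V
    to-cong  : ∀ {u v} → u G.≈ v → to u H.≈ to v
    from-cong : ∀ {u v} → u H.≈ v → from u G.≈ from v
    from∘to  : ∀ u → from (to u) G.≈ u
    to∘from  : ∀ v → to (from v) H.≈ v
    arc      : ∀ u v → G.Arc u v ⇔ H.Arc (to u) (to v)

record Mat2 : Set where
  constructor mat
  field
    m11 m12 m21 m22 : ℤ

open Mat2 public

det : Mat2 → ℤ
det M = m11 M * m22 M - m12 M * m21 M

ℤ² : Set
ℤ² = ℤ × ℤ

_+²_ : ℤ² → ℤ² → ℤ²
(a , b) +² (c , d) = (a + c , b + d)

_-²_ : ℤ² → ℤ² → ℤ²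
(a , b) -² (c , d) = (a - c , b - d)

_·_ : Mat2 → ℤ² → ℤ²
M · (x , y) = (m11 M * x + m12 M * y , m21 M * x + m22 M * y)

_≡[_]_ : ℤ² → Mat2 → ℤ² → Set
u ≡[ M ] v = ∃[ w ] (u -² v ≡ M · w)

e₁ e₂ : ℤ²
e₁ = (+ 1 , + 0)
e₂ = (+ 0 , + 1)

G⟨_,e₁,e₂⟩ : Mat2 → Digraph
G⟨ M ,e₁,e₂⟩ = record
  { V = ℤ²
  ; _≈_ = _≡[ M ]_
  ; Arc = λ u v → (v ≡[ M ] (u +² e₁)) ⊎ (v ≡[ M ] (u +² e₂))
  }

Cay[ℤ/_,_] : ℕ → List ℤ → Digraph
Cay[ℤ/ m′ , B ] = record
  { V = ℤ
  ; _≈_ = λ u v → (+ m′) ∣ (u - v)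
  ; Arc = λ u v → ∃[ b ] (b ∈ B × (+ m′) ∣ (v - (u + b)))
  }

IsCirculant : Digraph → Set
IsCirculant G = ∃[ m′ ] (NonZero m′ × ∃[ B ] (G ≅ Cay[ℤ/ m′ , B ]))

d₁ : Mat2 → ℕ
d₁ M = gcd (gcd ∣ m11 M ∣ ∣ m12 M ∣) (gcd ∣ m21 M ∣ ∣ m22 M ∣)

-- Write Λ = M ℤ², so the vertices are ℤ²/Λ and the arcs are u → u + e₁, u → u + e₂.
--
-- If Λ contains a vector (h , x) with gcd(h, x) = 1, the functional u ↦ u₁ x - u₂ h induces ℤ²/Λ ≅ ℤ/det M
-- and turns the graph into Cay(ℤ/|det M|, {x, -h}); when d₁ = 1 such a vector is found among the
-- (gcd(m₁₁, m₁₂) , b + c t) ∈ Λ by choosing t suitably.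
-- If m = 2g with g = gcd(m, m₂₂ + m₁₂, m₁₁ + m₂₁), then Λ contains (2, -2) but not (1, -1), and the level
-- u₁ + u₂ mod g splits the vertices into g pairs, each vertex pointing to both vertices of the next pair:
-- the graph is Cay(ℤ/2g, {1, 1 + g}).
-- Conversely let φ be an isomorphism onto Cay(ℤ/n, B). If (1, -1), (2, -2) ∉ Λ, comparing the out-neighbours
-- of u + e₁ and u + e₂ shows φ (u + e₁) = φ u + s and φ (u + e₂) = φ u + t for all u, so φ is affine;
-- then (t, -s) and (n, 0) lie in Λ and a s + b t ≡ 1 (mod n) by surjectivity, which forces d₁ = 1.
-- If (2, -2) ∈ Λ then d₁ ∣ 2, and when moreover (1, -1) ∉ Λ the divisibilities g ∣ m ∣ 2g, m ≠ g give m = 2g.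

module Submission where

open import Defs
open import Data.Nat as ℕ using (ℕ; zero; suc)
import Data.Nat.Properties as ℕP
import Data.Nat.Divisibility as ℕD
import Data.Nat.Coprimality as ℕC
open import Data.Nat.GCD using (gcd; gcd[m,n]∣m; gcd[m,n]∣n; gcd-greatest; gcd[m,n]≡0⇒m≡0; gcd[m,n]≡0⇒n≡0; gcd-GCD; module Bézout; c*gcd[m,n]≡gcd[cm,cn])
open import Data.Nat.Induction using (<-rec)
open import Data.Integer as ℤ using (ℤ; +_; -[1+_]; _+_; _-_; _*_; -_; ∣_∣; 0ℤ; 1ℤ; -1ℤ)
import Data.Integer.Properties as ℤP
import Data.Integer.Divisibility as ℤᵤ
open import Data.Integer.Divisibility.Signed as ℤ∣ using (_∣_; divides; _∣?_)
import Data.Integer.Coprimality as ℤC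
import Data.Integer.DivMod as ℤ÷
open import Data.Integer.Tactic.RingSolver using (solve-∀)
open import Data.Product using (∃-syntax; _×_; _,_; proj₁; proj₂)
open import Data.Sum as Sum using (_⊎_; inj₁; inj₂; [_,_]′)
open import Data.List using (List; []; _∷_)
open import Data.List.Membership.Propositional using (_∈_)
open import Data.List.Relation.Unary.Any using (here; there)
open import Data.Empty using (⊥; ⊥-elim)
open import Function using (id)
open import Function.Bundles using (_⇔_; mk⇔; Equivalence)
open import Function.Construct.Composition using (_⇔-∘_)
open import Function.Construct.Symmetry using (⇔-sym)
open import Relation.Binary.PropositionalEquality using (_≡_; _≢_; refl; sym; trans; cong; cong₂; subst; module ≡-Reasoning)
open import Relation.Nullary using (¬_; Dec; yes; no)

record _≡_[mod_] (x y k : ℤ) : Set where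
  constructor mod
  field unmod : k ∣ x - y
open _≡_[mod_]
infix 4 _≡_[mod_]

module _ {k : ℤ} where

  ≡ₘ-by : ∀ {x y x′ y′} → x - y ≡ x′ - y′ → x ≡ y [mod k ] → x′ ≡ y′ [mod k ]
  ≡ₘ-by eq (mod k∣) = mod (subst (k ∣_) eq k∣)

  ≡⇒≡ₘ : ∀ {x y} → x ≡ y → x ≡ y [mod k ]
  ≡⇒≡ₘ {x} refl = mod (divides 0ℤ (l x k))
    where
    l : ∀ x k → x - x ≡ 0ℤ * k
    l = solve-∀

  ≡ₘ-refl : ∀ {x} → x ≡ x [mod k ]
  ≡ₘ-refl = ≡⇒≡ₘ refl

  ≡ₘ-sym : ∀ {x y} → x ≡ y [mod k ] → y ≡ x [mod k ]
  ≡ₘ-sym {x} {y} (mod k∣) = mod (subst (k ∣_) (l x y) (ℤ∣.∣m⇒∣-m k∣))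
    where
    l : ∀ x y → - (x - y) ≡ y - x
    l = solve-∀

  ≡ₘ-trans : ∀ {x y z} → x ≡ y [mod k ] → y ≡ z [mod k ] → x ≡ z [mod k ]
  ≡ₘ-trans {x} {y} {z} (mod k∣₁) (mod k∣₂) = mod (subst (k ∣_) (l x y z) (ℤ∣.∣m∣n⇒∣m+n k∣₁ k∣₂))
    where
    l : ∀ x y z → (x - y) + (y - z) ≡ x - z
    l = solve-∀

  +-congₘ : ∀ {x y x′ y′} → x ≡ y [mod k ] → x′ ≡ y′ [mod k ] → x + x′ ≡ y + y′ [mod k ]
  +-congₘ {x} {y} {x′} {y′} (mod k∣₁) (mod k∣₂) = mod (subst (k ∣_) (l x y x′ y′) (ℤ∣.∣m∣n⇒∣m+n k∣₁ k∣₂))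
    where
    l : ∀ x y x′ y′ → (x - y) + (x′ - y′) ≡ (x + x′) - (y + y′)
    l = solve-∀

  +-congˡₘ : ∀ a {x y} → x ≡ y [mod k ] → a + x ≡ a + y [mod k ]
  +-congˡₘ a = +-congₘ (≡ₘ-refl {a})

  +-congʳₘ : ∀ a {x y} → x ≡ y [mod k ] → x + a ≡ y + a [mod k ]
  +-congʳₘ a x≡y = +-congₘ x≡y ≡ₘ-refl

  +-cancelˡₘ : ∀ a {x y} → a + x ≡ a + y [mod k ] → x ≡ y [mod k ]
  +-cancelˡₘ a {x} {y} = ≡ₘ-by (l a x y)
    where
    l : ∀ a x y → (a + x) - (a + y) ≡ x - y
    l = solve-∀

  +-cancelʳₘ : ∀ a {x y} → x + a ≡ y + a [mod k ] → x ≡ y [mod k ]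
  +-cancelʳₘ a {x} {y} = ≡ₘ-by (l a x y)
    where
    l : ∀ a x y → (x + a) - (y + a) ≡ x - y
    l = solve-∀

record _∈Λ_ (u : ℤ²) (M : Mat2) : Set where
  constructor image
  field
    preimage : ℤ²
    is-image : u ≡ M · preimage
infix 4 _∈Λ_

-- Congruence modulo the lattice M ℤ²; it is  _≡[ M ]_  wrapped so that M, u and v can be inferred.
record _≡²_[mod_] (u v : ℤ²) (M : Mat2) : Set where
  constructor mod²
  field unmod² : (u -² v) ∈Λ M
open _≡²_[mod_]
infix 4 _≡²_[mod_]

_*²_ : ℤ → ℤ² → ℤ²
k *² (a , b) = (k * a , k * b)

infix 4 _∣²_
_∣²_ : ℤ → ℤ² → Set
k ∣² (a , b) = (k ∣ a) × (k ∣ b)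

adj : Mat2 → ℤ² → ℤ²
adj M (a , b) = (m22 M * a - m12 M * b , m11 M * b - m21 M * a)

Λ-cast : ∀ {M u v} → u ∈Λ M → u ≡ v → v ∈Λ M
Λ-cast u∈Λ refl = u∈Λ

≡[]⇒≡² : ∀ {M u v} → u ≡[ M ] v → u ≡² v [mod M ]
≡[]⇒≡² (w , eq) = mod² (image w eq)

≡²⇒≡[] : ∀ {M u v} → u ≡² v [mod M ] → u ≡[ M ] v
≡²⇒≡[] (mod² (image w eq)) = w , eq

Λ-0 : ∀ {M} → (0ℤ , 0ℤ) ∈Λ M
Λ-0 {mat p q r s} = image (0ℤ , 0ℤ) (cong₂ _,_ (l p q) (l r s))
  where
  l : ∀ p q → 0ℤ ≡ p * 0ℤ + q * 0ℤ
  l = solve-∀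

Λ-+ : ∀ {M u v} → u ∈Λ M → v ∈Λ M → u +² v ∈Λ M
Λ-+ {mat p q r s} (image (w₁ , w₂) refl) (image (v₁ , v₂) refl) =
  image (w₁ + v₁ , w₂ + v₂) (cong₂ _,_ (l p q w₁ w₂ v₁ v₂) (l r s w₁ w₂ v₁ v₂))
  where
  l : ∀ p q w₁ w₂ v₁ v₂ → (p * w₁ + q * w₂) + (p * v₁ + q * v₂) ≡ p * (w₁ + v₁) + q * (w₂ + v₂)
  l = solve-∀

Λ-* : ∀ {M u} k → u ∈Λ M → k *² u ∈Λ M
Λ-* {mat p q r s} k (image (w₁ , w₂) refl) =
  image (k * w₁ , k * w₂) (cong₂ _,_ (l p q w₁ w₂ k) (l r s w₁ w₂ k))
  where
  l : ∀ p q w₁ w₂ k → k * (p * w₁ + q * w₂) ≡ p * (k * w₁) + q * (k * w₂)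
  l = solve-∀

Λ-det : ∀ {M} u → det M *² u ∈Λ M
Λ-det {mat p q r s} (a , b) = image (adj (mat p q r s) (a , b)) (cong₂ _,_ (l₁ p q r s a b) (l₂ p q r s a b))
  where
  l₁ : ∀ p q r s a b → (p * s - q * r) * a ≡ p * (s * a - q * b) + q * (p * b - r * a)
  l₁ = solve-∀
  l₂ : ∀ p q r s a b → (p * s - q * r) * b ≡ r * (s * a - q * b) + s * (p * b - r * a)
  l₂ = solve-∀

Λ⇒det∣adj : ∀ {M u} → u ∈Λ M → det M ∣² adj M u
Λ⇒det∣adj {mat p q r s} (image (w₁ , w₂) refl) = divides w₁ (l₁ p q r s w₁ w₂) , divides w₂ (l₂ p q r s w₁ w₂)
  where
  l₁ : ∀ p q r s w₁ w₂ → s * (p * w₁ + q * w₂) - q * (r * w₁ + s * w₂) ≡ w₁ * (p * s - q * r)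
  l₁ = solve-∀
  l₂ : ∀ p q r s w₁ w₂ → p * (r * w₁ + s * w₂) - r * (p * w₁ + q * w₂) ≡ w₂ * (p * s - q * r)
  l₂ = solve-∀

-- adj M ∘ M = det M, so dividing by det M inverts M on the image.
det∣adj⇒Λ : ∀ {M} → det M ≢ 0ℤ → ∀ {u} → det M ∣² adj M u → u ∈Λ M
det∣adj⇒Λ {M@(mat p q r s)} D≢0 {u@(a , b)} (divides k₁ e₁ , divides k₂ e₂) = image (k₁ , k₂) (cong₂ _,_ a≡ b≡)
  where
  open ≡-Reasoning
  D : ℤ
  D = p * s - q * r
  instance
    D-nonZero : ℤ.NonZero D
    D-nonZero = ℤ.≢-nonZero D≢0
  D*u≡ : D *² u ≡ M · adj M u
  D*u≡ = _∈Λ_.is-image (Λ-det {M} u)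
  l : ∀ p q k₁ k₂ D → p * (k₁ * D) + q * (k₂ * D) ≡ D * (p * k₁ + q * k₂)
  l = solve-∀
  a≡ : a ≡ p * k₁ + q * k₂
  a≡ = ℤP.*-cancelˡ-≡ D a (p * k₁ + q * k₂) (begin
    D * a                                      ≡⟨ cong proj₁ D*u≡ ⟩
    p * (s * a - q * b) + q * (p * b - r * a)  ≡⟨ cong₂ (λ x y → p * x + q * y) e₁ e₂ ⟩
    p * (k₁ * D) + q * (k₂ * D)                ≡⟨ l p q k₁ k₂ D ⟩
    D * (p * k₁ + q * k₂)                      ∎)
  b≡ : b ≡ r * k₁ + s * k₂
  b≡ = ℤP.*-cancelˡ-≡ D b (r * k₁ + s * k₂) (begin
    D * b                                      ≡⟨ cong proj₂ D*u≡ ⟩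
    r * (s * a - q * b) + s * (p * b - r * a)  ≡⟨ cong₂ (λ x y → r * x + s * y) e₁ e₂ ⟩
    r * (k₁ * D) + s * (k₂ * D)                ≡⟨ l r s k₁ k₂ D ⟩
    D * (r * k₁ + s * k₂)                      ∎)

Λ? : ∀ {M} → det M ≢ 0ℤ → ∀ u → Dec (u ∈Λ M)
Λ? {M} D≢0 (a , b) with det M ∣? proj₁ (adj M (a , b)) | det M ∣? proj₂ (adj M (a , b))
... | yes d₁ | yes d₂ = yes (det∣adj⇒Λ D≢0 (d₁ , d₂))
... | no ¬d₁ | _      = no λ u∈ → ¬d₁ (proj₁ (Λ⇒det∣adj u∈))
... | yes _  | no ¬d₂ = no λ u∈ → ¬d₂ (proj₂ (Λ⇒det∣adj u∈))

Λ⇒d₁∣ : ∀ {M u} → u ∈Λ M → (+ d₁ M) ∣² u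
Λ⇒d₁∣ {mat p q r s} (image (w₁ , w₂) refl) =
  ℤ∣.∣m∣n⇒∣m+n (ℤ∣.∣m⇒∣m*n w₁ d∣p) (ℤ∣.∣m⇒∣m*n w₂ d∣q) ,
  ℤ∣.∣m∣n⇒∣m+n (ℤ∣.∣m⇒∣m*n w₁ d∣r) (ℤ∣.∣m⇒∣m*n w₂ d∣s)
  where
  g₁ g₂ : ℕ
  g₁ = gcd ∣ p ∣ ∣ q ∣
  g₂ = gcd ∣ r ∣ ∣ s ∣
  d : ℤ
  d = + gcd g₁ g₂
  d∣p : d ∣ p
  d∣p = ℤ∣.∣ᵤ⇒∣ (ℕD.∣-trans (gcd[m,n]∣m g₁ g₂) (gcd[m,n]∣m ∣ p ∣ ∣ q ∣))
  d∣q : d ∣ q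
  d∣q = ℤ∣.∣ᵤ⇒∣ (ℕD.∣-trans (gcd[m,n]∣m g₁ g₂) (gcd[m,n]∣n ∣ p ∣ ∣ q ∣))
  d∣r : d ∣ r
  d∣r = ℤ∣.∣ᵤ⇒∣ (ℕD.∣-trans (gcd[m,n]∣n g₁ g₂) (gcd[m,n]∣m ∣ r ∣ ∣ s ∣))
  d∣s : d ∣ s
  d∣s = ℤ∣.∣ᵤ⇒∣ (ℕD.∣-trans (gcd[m,n]∣n g₁ g₂) (gcd[m,n]∣n ∣ r ∣ ∣ s ∣))

≡²-by : ∀ {M d u v} → d ∈Λ M → d ≡ u -² v → u ≡² v [mod M ]
≡²-by d∈ refl = mod² d∈

≡⇒≡² : ∀ {M u v} → u ≡ v → u ≡² v [mod M ]
≡⇒≡² {u = a , b} refl = ≡²-by Λ-0 (cong₂ _,_ (l a) (l b))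
  where
  l : ∀ a → 0ℤ ≡ a - a
  l = solve-∀

≡²-refl : ∀ {M u} → u ≡² u [mod M ]
≡²-refl = ≡⇒≡² refl

≡²-sym : ∀ {M u v} → u ≡² v [mod M ] → v ≡² u [mod M ]
≡²-sym {u = a , b} {c , d} (mod² d∈) = ≡²-by (Λ-* -1ℤ d∈) (cong₂ _,_ (l a c) (l b d))
  where
  l : ∀ a c → -1ℤ * (a - c) ≡ c - a
  l = solve-∀

≡²-trans : ∀ {M u v w} → u ≡² v [mod M ] → v ≡² w [mod M ] → u ≡² w [mod M ]
≡²-trans {u = a , b} {c , d} {e , f} (mod² d₁∈) (mod² d₂∈) = ≡²-by (Λ-+ d₁∈ d₂∈) (cong₂ _,_ (l a c e) (l b d f))
  where
  l : ∀ a c e → (a - c) + (c - e) ≡ a - e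
  l = solve-∀

Λ⇒≡[] : ∀ {M} u v → (u -² v) ∈Λ M → u ≡[ M ] v
Λ⇒≡[] _ _ (image w eq) = w , eq

≡[]-refl : ∀ {M} u → u ≡[ M ] u
≡[]-refl {M} u = ≡²⇒≡[] (≡²-refl {M} {u})

≡²0⇒∈Λ : ∀ {M a b} → (a , b) ≡² (0ℤ , 0ℤ) [mod M ] → (a , b) ∈Λ M
≡²0⇒∈Λ {a = a} {b} (mod² d∈Λ) = Λ-cast d∈Λ (cong₂ _,_ (ℤP.+-identityʳ a) (ℤP.+-identityʳ b))

≢-by-difference : ∀ {M d u v} → ¬ d ∈Λ M → u -² v ≡ d → ¬ u ≡² v [mod M ]
≢-by-difference d∉Λ refl (mod² d∈Λ) = d∉Λ d∈Λ

≡ₘ⇒∣ᵤ : ∀ {k x y} → x ≡ y [mod k ] → (+ ∣ k ∣) ℤᵤ.∣ (x - y)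
≡ₘ⇒∣ᵤ (mod k∣) = ℤ∣.∣⇒∣ᵤ k∣

∣ᵤ⇒≡ₘ : ∀ {k x y} → (+ ∣ k ∣) ℤᵤ.∣ (x - y) → x ≡ y [mod k ]
∣ᵤ⇒≡ₘ k∣ = mod (ℤ∣.∣ᵤ⇒∣ k∣)

∣i∣-as-multiple : ∀ a → ∃[ σ ] (+ ∣ a ∣ ≡ σ * a)
∣i∣-as-multiple (+ n)    = 1ℤ , sym (ℤP.*-identityˡ (+ n))
∣i∣-as-multiple -[1+ n ] = -1ℤ , sym (ℤP.-1*i≡-i -[1+ n ])

+-≡⇒pos-difference : ∀ {d a b} → d ℕ.+ a ≡ b → + d ≡ + b - + a
+-≡⇒pos-difference {d} {a} refl = begin
  + d                ≡⟨ l (+ d) (+ a) ⟩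
  (+ d + + a) - + a  ≡⟨ cong (_- + a) (ℤP.pos-+ d a) ⟨
  + (d ℕ.+ a) - + a  ∎
  where
  open ≡-Reasoning
  l : ∀ d a → d ≡ (d + a) - a
  l = solve-∀

Bézout-identityℤ : ∀ {d m n} → Bézout.Identity d m n → ∃[ x ] ∃[ y ] (x * + m + y * + n ≡ + d)
Bézout-identityℤ {d} {m} {n} (Bézout.+- x y eq) = + x , - + y , (begin
  + x * + m + - + y * + n        ≡⟨ l (+ x) (+ m) (+ y) (+ n) ⟩
  + x * + m - + y * + n          ≡⟨ cong₂ _-_ (ℤP.pos-* x m) (ℤP.pos-* y n) ⟨
  + (x ℕ.* m) - + (y ℕ.* n)      ≡⟨ +-≡⇒pos-difference eq ⟨
  + d                            ∎)
  where
  open ≡-Reasoning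
  l : ∀ x m y n → x * m + - y * n ≡ x * m - y * n
  l = solve-∀
Bézout-identityℤ {d} {m} {n} (Bézout.-+ x y eq) = - + x , + y , (begin
  - + x * + m + + y * + n        ≡⟨ l (+ x) (+ m) (+ y) (+ n) ⟩
  + y * + n - + x * + m          ≡⟨ cong₂ _-_ (ℤP.pos-* y n) (ℤP.pos-* x m) ⟨
  + (y ℕ.* n) - + (x ℕ.* m)      ≡⟨ +-≡⇒pos-difference eq ⟨
  + d                            ∎)
  where
  open ≡-Reasoning
  l : ∀ x m y n → - x * m + y * n ≡ y * n - x * m
  l = solve-∀

bézout : ∀ a b → ∃[ x ] ∃[ y ] (x * a + y * b ≡ + gcd ∣ a ∣ ∣ b ∣)
bézout a b with Bézout-identityℤ (Bézout.identity (gcd-GCD ∣ a ∣ ∣ b ∣)) | ∣i∣-as-multiple a | ∣i∣-as-multiple b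
... | x , y , eq | σ , ∣a∣≡ | τ , ∣b∣≡ = x * σ , y * τ , (begin
  x * σ * a + y * τ * b          ≡⟨ l x σ a y τ b ⟩
  x * (σ * a) + y * (τ * b)      ≡⟨ cong₂ (λ u v → x * u + y * v) ∣a∣≡ ∣b∣≡ ⟨
  x * (+ ∣ a ∣) + y * (+ ∣ b ∣)  ≡⟨ eq ⟩
  + gcd ∣ a ∣ ∣ b ∣              ∎)
  where
  open ≡-Reasoning
  l : ∀ x σ a y τ b → x * σ * a + y * τ * b ≡ x * (σ * a) + y * (τ * b)
  l = solve-∀

coprime-bézout : ∀ {a b} → ℤC.Coprime a b → ∃[ x ] ∃[ y ] (x * a + y * b ≡ 1ℤ)
coprime-bézout {a} {b} cop =
  proj₁ (bézout a b) , proj₁ (proj₂ (bézout a b)) , trans (proj₂ (proj₂ (bézout a b))) (cong +_ (ℕC.coprime⇒gcd≡1 cop))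

module _ (h : ℕ) (b : ℤ) where

  DividesCoprimeDivisors : ℕ → Set
  DividesCoprimeDivisors k = ∀ {e} → e ℕD.∣ h → ℕC.Coprime e ∣ b ∣ → e ℕD.∣ k

  -- Divide out gcd(k, b) until it is 1; the result is the largest divisor of h coprime to b.
  coprime-part : h ≢ 0 → ∃[ k ] (ℕC.Coprime k ∣ b ∣ × DividesCoprimeDivisors k)
  coprime-part h≢0 = <-rec Goal strip h h≢0 (λ e∣h _ → e∣h)
    where
    Goal : ℕ → Set
    Goal k = k ≢ 0 → DividesCoprimeDivisors k → ∃[ k′ ] (ℕC.Coprime k′ ∣ b ∣ × DividesCoprimeDivisors k′)
    strip : ∀ k → (∀ {j} → j ℕ.< k → Goal j) → Goal k
    strip k rec k≢0 inv with gcd k ∣ b ∣ ℕ.≟ 1 | gcd[m,n]∣m k ∣ b ∣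
    ... | yes g≡1 | _ = k , ℕC.gcd≡1⇒coprime g≡1 , inv
    ... | no g≢1 | ℕD.divides k′ k≡k′g = rec k′<k k′≢0 inv′
      where
      g : ℕ
      g = gcd k ∣ b ∣
      k′≢0 : k′ ≢ 0
      k′≢0 refl = k≢0 k≡k′g
      g≢0 : g ≢ 0
      g≢0 g≡0 = k≢0 (gcd[m,n]≡0⇒m≡0 g≡0)
      1<g : 1 ℕ.< g
      1<g = ℕP.≤∧≢⇒< (ℕP.n≢0⇒n>0 g≢0) (λ 1≡g → g≢1 (sym 1≡g))
      k′<k : k′ ℕ.< k
      k′<k = subst (k′ ℕ.<_) (sym k≡k′g) (ℕP.m<m*n k′ g {{ℕ.≢-nonZero k′≢0}} 1<g)
      inv′ : DividesCoprimeDivisors k′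
      inv′ e∣h cop = ℕC.coprime-divisor (λ (d∣e , d∣g) → cop (d∣e , ℕD.∣-trans d∣g (gcd[m,n]∣n k ∣ b ∣)))
                       (subst (_ ℕD.∣_) (trans k≡k′g (ℕP.*-comm k′ g)) (inv e∣h cop))

∃-coprime-shift : ∀ h b c → h ≢ 0 → (∀ {f} → f ℕD.∣ h → f ℕD.∣ ∣ b ∣ → f ℕD.∣ ∣ c ∣ → f ≡ 1) →
                  ∃[ t ] ℤC.Coprime (b + c * t) (+ h)
∃-coprime-shift h b c h≢0 gcd[h,b,c]≡1 with coprime-part h b h≢0
... | k , k⊥b , dividesCoprime = + k , λ (d∣X , d∣h) → X⊥k (d∣X , dividesCoprime d∣h (d⊥b d∣X d∣h))
  where
  X : ℤ
  X = b + c * + k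
  l₁ : ∀ b c k → (b + c * k) - c * k ≡ b
  l₁ = solve-∀
  l₂ : ∀ b c k → (b + c * k) - b ≡ k * c
  l₂ = solve-∀
  X⊥k : ℕC.Coprime ∣ X ∣ k
  X⊥k {f} (f∣X , f∣k) = k⊥b (f∣k , ℤ∣.∣⇒∣ᵤ (subst (+ f ∣_) (l₁ b c (+ k))
                      (ℤ∣.∣m∣n⇒∣m-n (ℤ∣.∣ᵤ⇒∣ {+ f} {X} f∣X) (ℤ∣.∣n⇒∣m*n c (ℤ∣.∣ᵤ⇒∣ {+ f} {+ k} f∣k)))))
  d⊥b : ∀ {d} → d ℕD.∣ ∣ X ∣ → d ℕD.∣ h → ℕC.Coprime d ∣ b ∣
  d⊥b d∣X d∣h {f} (f∣d , f∣b) = gcd[h,b,c]≡1 (ℕD.∣-trans f∣d d∣h) f∣b f∣c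
    where
    f∣X : f ℕD.∣ ∣ X ∣
    f∣X = ℕD.∣-trans f∣d d∣X
    f∣c : f ℕD.∣ ∣ c ∣
    f∣c = ℤC.coprime-divisor (+ f) (+ k) c (λ (g∣f , g∣k) → X⊥k (ℕD.∣-trans g∣f f∣X , g∣k))
            (ℤ∣.∣⇒∣ᵤ (subst (+ f ∣_) (l₂ b c (+ k)) (ℤ∣.∣m∣n⇒∣m-n (ℤ∣.∣ᵤ⇒∣ {+ f} {X} f∣X) (ℤ∣.∣ᵤ⇒∣ {+ f} {b} f∣b))))

cross : ℤ² → ℤ² → ℤ
cross (a , b) (c , d) = a * d - b * c

Λ-cross : ∀ {M u v} → u ∈Λ M → v ∈Λ M → det M ∣ cross u v
Λ-cross {mat p q r s} (image (u₁ , u₂) refl) (image (v₁ , v₂) refl) = divides (u₁ * v₂ - u₂ * v₁) (l p q r s u₁ u₂ v₁ v₂)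
  where
  l : ∀ p q r s u₁ u₂ v₁ v₂ →
      (p * u₁ + q * u₂) * (r * v₁ + s * v₂) - (r * u₁ + s * u₂) * (p * v₁ + q * v₂) ≡ (u₁ * v₂ - u₂ * v₁) * (p * s - q * r)
  l = solve-∀

module PrimitiveVector {M : Mat2} {h x x₀ y₀ : ℤ} (hx∈Λ : (h , x) ∈Λ M) (bézout-hx : x * x₀ + h * y₀ ≡ 1ℤ) where

  φ : ℤ² → ℤ
  φ u = cross u (h , x)

  ψ : ℤ → ℤ²
  ψ j = (j * x₀ , - (j * y₀))

  φ-cong : ∀ {u v} → u ≡² v [mod M ] → φ u ≡ φ v [mod det M ]
  φ-cong {a , b} {c , d} (mod² d∈) = mod (subst (det M ∣_) (l a b c d h x) (Λ-cross d∈ hx∈Λ))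
    where
    l : ∀ a b c d h x → (a - c) * x - (b - d) * h ≡ (a * x - b * h) - (c * x - d * h)
    l = solve-∀

  ψ-cong : ∀ {j j′} → j ≡ j′ [mod det M ] → ψ j ≡² ψ j′ [mod M ]
  ψ-cong {j} {j′} (mod (divides k j-j′≡kD)) = ≡²-by (Λ-* k (Λ-det {M} (x₀ , - y₀))) (cong₂ _,_ c₁ c₂)
    where
    open ≡-Reasoning
    c₁ : k * (det M * x₀) ≡ j * x₀ - j′ * x₀
    c₁ = begin
      k * (det M * x₀)   ≡⟨ l₁ k (det M) x₀ ⟩
      (k * det M) * x₀   ≡⟨ cong (_* x₀) j-j′≡kD ⟨
      (j - j′) * x₀      ≡⟨ l₂ j j′ x₀ ⟩
      j * x₀ - j′ * x₀   ∎
      where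
      l₁ : ∀ k D x₀ → k * (D * x₀) ≡ (k * D) * x₀
      l₁ = solve-∀
      l₂ : ∀ j j′ x₀ → (j - j′) * x₀ ≡ j * x₀ - j′ * x₀
      l₂ = solve-∀
    c₂ : k * (det M * - y₀) ≡ - (j * y₀) - - (j′ * y₀)
    c₂ = begin
      k * (det M * - y₀)        ≡⟨ l₁ k (det M) y₀ ⟩
      - ((k * det M) * y₀)      ≡⟨ cong (λ z → - (z * y₀)) j-j′≡kD ⟨
      - ((j - j′) * y₀)         ≡⟨ l₂ j j′ y₀ ⟩
      - (j * y₀) - - (j′ * y₀)  ∎
      where
      l₁ : ∀ k D y₀ → k * (D * - y₀) ≡ - ((k * D) * y₀)
      l₁ = solve-∀
      l₂ : ∀ j j′ y₀ → - ((j - j′) * y₀) ≡ - (j * y₀) - - (j′ * y₀)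
      l₂ = solve-∀

  φ∘ψ : ∀ j → φ (ψ j) ≡ j
  φ∘ψ j = begin
    j * x₀ * x - - (j * y₀) * h  ≡⟨ l j x h x₀ y₀ ⟩
    j * (x * x₀ + h * y₀)        ≡⟨ cong (j *_) bézout-hx ⟩
    j * 1ℤ                       ≡⟨ ℤP.*-identityʳ j ⟩
    j                            ∎
    where
    open ≡-Reasoning
    l : ∀ j x h x₀ y₀ → j * x₀ * x - - (j * y₀) * h ≡ j * (x * x₀ + h * y₀)
    l = solve-∀

  -- ψ (φ u) - u = - (a y₀ + b x₀) (h , x)
  ψ∘φ : ∀ u → ψ (φ u) ≡² u [mod M ]
  ψ∘φ (a , b) = ≡²-by (Λ-* (- (a * y₀ + b * x₀)) hx∈Λ) (cong₂ _,_ c₁ c₂)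
    where
    open ≡-Reasoning
    c₁ : - (a * y₀ + b * x₀) * h ≡ (a * x - b * h) * x₀ - a
    c₁ = begin
      - (a * y₀ + b * x₀) * h                       ≡⟨ l₁ a b x h x₀ y₀ ⟩
      (a * x - b * h) * x₀ - a * (x * x₀ + h * y₀)  ≡⟨ cong (λ z → (a * x - b * h) * x₀ - a * z) bézout-hx ⟩
      (a * x - b * h) * x₀ - a * 1ℤ                 ≡⟨ cong (λ z → (a * x - b * h) * x₀ - z) (ℤP.*-identityʳ a) ⟩
      (a * x - b * h) * x₀ - a                      ∎
      where
      l₁ : ∀ a b x h x₀ y₀ → - (a * y₀ + b * x₀) * h ≡ (a * x - b * h) * x₀ - a * (x * x₀ + h * y₀)
      l₁ = solve-∀
    c₂ : - (a * y₀ + b * x₀) * x ≡ - ((a * x - b * h) * y₀) - b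
    c₂ = begin
      - (a * y₀ + b * x₀) * x                          ≡⟨ l₂ a b x h x₀ y₀ ⟩
      - ((a * x - b * h) * y₀) - b * (x * x₀ + h * y₀) ≡⟨ cong (λ z → - ((a * x - b * h) * y₀) - b * z) bézout-hx ⟩
      - ((a * x - b * h) * y₀) - b * 1ℤ                ≡⟨ cong (λ z → - ((a * x - b * h) * y₀) - z) (ℤP.*-identityʳ b) ⟩
      - ((a * x - b * h) * y₀) - b                     ∎
      where
      l₂ : ∀ a b x h x₀ y₀ → - (a * y₀ + b * x₀) * x ≡ - ((a * x - b * h) * y₀) - b * (x * x₀ + h * y₀)
      l₂ = solve-∀

  φ-injective : ∀ {u v} → φ u ≡ φ v [mod det M ] → u ≡² v [mod M ]
  φ-injective {u} {v} φu≡φv = ≡²-trans (≡²-sym (ψ∘φ u)) (≡²-trans (ψ-cong φu≡φv) (ψ∘φ v))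

  φ-+e₁ : ∀ u → φ (u +² e₁) ≡ φ u + x
  φ-+e₁ (a , b) = l a b x h
    where
    l : ∀ a b x h → (a + 1ℤ) * x - (b + 0ℤ) * h ≡ (a * x - b * h) + x
    l = solve-∀

  φ-+e₂ : ∀ u → φ (u +² e₂) ≡ φ u + - h
  φ-+e₂ (a , b) = l a b x h
    where
    l : ∀ a b x h → (a + 0ℤ) * x - (b + 1ℤ) * h ≡ (a * x - b * h) + - h
    l = solve-∀

  φ-arc : ∀ u v e {β} → φ (u +² e) ≡ φ u + β → v ≡² u +² e [mod M ] → φ v ≡ φ u + β [mod det M ]
  φ-arc _ _ _ φ-+ v≡ = ≡ₘ-trans (φ-cong v≡) (≡⇒≡ₘ φ-+)

  φ-arc⁻¹ : ∀ u v e {β} → φ (u +² e) ≡ φ u + β → φ v ≡ φ u + β [mod det M ] → v ≡² u +² e [mod M ]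
  φ-arc⁻¹ _ _ _ φ-+ φv≡ = φ-injective (≡ₘ-trans φv≡ (≡⇒≡ₘ (sym φ-+)))

  ≅Cay : G⟨ M ,e₁,e₂⟩ ≅ Cay[ℤ/ ∣ det M ∣ , x ∷ - h ∷ [] ]
  ≅Cay = record
    { to        = φ
    ; from      = ψ
    ; to-cong   = λ {u} {v} u≡v → ≡ₘ⇒∣ᵤ (φ-cong (≡[]⇒≡² {M} {u} {v} u≡v))
    ; from-cong = λ {j} {j′} j≡j′ → ≡²⇒≡[] (ψ-cong (∣ᵤ⇒≡ₘ {det M} {j} {j′} j≡j′))
    ; from∘to   = λ u → ≡²⇒≡[] (ψ∘φ u)
    ; to∘from   = λ j → ≡ₘ⇒∣ᵤ {det M} (≡⇒≡ₘ (φ∘ψ j))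
    ; arc       = λ u v → mk⇔ (to-arc u v) (from-arc u v)
    }
    where
    to-arc : ∀ u v → (v ≡[ M ] (u +² e₁)) ⊎ (v ≡[ M ] (u +² e₂)) →
             ∃[ b ] (b ∈ x ∷ - h ∷ [] × (+ ∣ det M ∣) ℤᵤ.∣ (φ v - (φ u + b)))
    to-arc u v (inj₁ v≡) = x , here refl , ≡ₘ⇒∣ᵤ (φ-arc u v e₁ (φ-+e₁ u) (≡[]⇒≡² {M} {v} {u +² e₁} v≡))
    to-arc u v (inj₂ v≡) = - h , there (here refl) , ≡ₘ⇒∣ᵤ (φ-arc u v e₂ (φ-+e₂ u) (≡[]⇒≡² {M} {v} {u +² e₂} v≡))
    from-arc : ∀ u v → ∃[ b ] (b ∈ x ∷ - h ∷ [] × (+ ∣ det M ∣) ℤᵤ.∣ (φ v - (φ u + b))) →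
               (v ≡[ M ] (u +² e₁)) ⊎ (v ≡[ M ] (u +² e₂))
    from-arc u v (_ , here refl , φv≡) = inj₁ (≡²⇒≡[] (φ-arc⁻¹ u v e₁ (φ-+e₁ u) (∣ᵤ⇒≡ₘ {det M} {φ v} {φ u + x} φv≡)))
    from-arc u v (_ , there (here refl) , φv≡) = inj₂ (≡²⇒≡[] (φ-arc⁻¹ u v e₂ (φ-+e₂ u) (∣ᵤ⇒≡ₘ {det M} {φ v} {φ u + - h} φv≡)))

-- Take h = gcd(p, q) = x p + y q; the vectors of Λ M with first coordinate h are (h , b + c t),
-- and gcd(h, b, c) divides every entry of M.
module PrimitiveVectorOfD₁≡1 (p q r s : ℤ) (D≢0 : p * s - q * r ≢ 0ℤ) (d₁≡1 : d₁ (mat p q r s) ≡ 1) where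

  h : ℕ
  h = gcd ∣ p ∣ ∣ q ∣

  H : ℤ
  H = + h

  h≢0 : h ≢ 0
  h≢0 h≡0 = D≢0 (begin
    p * s - q * r      ≡⟨ cong₂ (λ p q → p * s - q * r) (ℤP.∣i∣≡0⇒i≡0 {p} (gcd[m,n]≡0⇒m≡0 h≡0)) (ℤP.∣i∣≡0⇒i≡0 {q} (gcd[m,n]≡0⇒n≡0 ∣ p ∣ h≡0)) ⟩
    0ℤ * s - 0ℤ * r    ≡⟨ l s r ⟩
    0ℤ                 ∎)
    where
    open ≡-Reasoning
    l : ∀ s r → 0ℤ * s - 0ℤ * r ≡ 0ℤ
    l = solve-∀

  H∣p : H ∣ p
  H∣p = ℤ∣.∣ᵤ⇒∣ (gcd[m,n]∣m ∣ p ∣ ∣ q ∣)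

  H∣q : H ∣ q
  H∣q = ℤ∣.∣ᵤ⇒∣ (gcd[m,n]∣n ∣ p ∣ ∣ q ∣)

  a₁ a₂ x y : ℤ
  a₁ = ℤ∣.quotient H∣p
  a₂ = ℤ∣.quotient H∣q
  x = proj₁ (bézout p q)
  y = proj₁ (proj₂ (bézout p q))

  p≡ : p ≡ a₁ * H
  p≡ = ℤ∣._∣_.equality H∣p

  q≡ : q ≡ a₂ * H
  q≡ = ℤ∣._∣_.equality H∣q

  xa₁+ya₂≡1 : x * a₁ + y * a₂ ≡ 1ℤ
  xa₁+ya₂≡1 = ℤP.*-cancelˡ-≡ H (x * a₁ + y * a₂) 1ℤ {{ℕ.≢-nonZero h≢0}} (begin
    H * (x * a₁ + y * a₂)        ≡⟨ l H x y a₁ a₂ ⟩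
    x * (a₁ * H) + y * (a₂ * H)  ≡⟨ cong₂ (λ p q → x * p + y * q) p≡ q≡ ⟨
    x * p + y * q                ≡⟨ proj₂ (proj₂ (bézout p q)) ⟩
    H                            ≡⟨ ℤP.*-identityʳ H ⟨
    H * 1ℤ                       ∎)
    where
    open ≡-Reasoning
    l : ∀ H x y a₁ a₂ → H * (x * a₁ + y * a₂) ≡ x * (a₁ * H) + y * (a₂ * H)
    l = solve-∀

  b c : ℤ
  b = r * x + s * y
  c = a₁ * s - a₂ * r

  r≡ : r ≡ a₁ * b - y * c
  r≡ = begin
    r                         ≡⟨ ℤP.*-identityʳ r ⟨
    r * 1ℤ                    ≡⟨ cong (r *_) xa₁+ya₂≡1 ⟨
    r * (x * a₁ + y * a₂)     ≡⟨ l r s x y a₁ a₂ ⟩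
    a₁ * b - y * c            ∎
    where
    open ≡-Reasoning
    l : ∀ r s x y a₁ a₂ → r * (x * a₁ + y * a₂) ≡ a₁ * (r * x + s * y) - y * (a₁ * s - a₂ * r)
    l = solve-∀

  s≡ : s ≡ a₂ * b + x * c
  s≡ = begin
    s                         ≡⟨ ℤP.*-identityʳ s ⟨
    s * 1ℤ                    ≡⟨ cong (s *_) xa₁+ya₂≡1 ⟨
    s * (x * a₁ + y * a₂)     ≡⟨ l r s x y a₁ a₂ ⟩
    a₂ * b + x * c            ∎
    where
    open ≡-Reasoning
    l : ∀ r s x y a₁ a₂ → s * (x * a₁ + y * a₂) ≡ a₂ * (r * x + s * y) + x * (a₁ * s - a₂ * r)
    l = solve-∀

  gcd[h,b,c]≡1 : ∀ {f} → f ℕD.∣ h → f ℕD.∣ ∣ b ∣ → f ℕD.∣ ∣ c ∣ → f ≡ 1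
  gcd[h,b,c]≡1 {f} f∣h f∣b f∣c = ℕD.∣1⇒≡1 (subst (f ℕD.∣_) d₁≡1
    (gcd-greatest (gcd-greatest (ℤ∣.∣⇒∣ᵤ F∣p) (ℤ∣.∣⇒∣ᵤ F∣q)) (gcd-greatest (ℤ∣.∣⇒∣ᵤ F∣r) (ℤ∣.∣⇒∣ᵤ F∣s))))
    where
    F : ℤ
    F = + f
    F∣H : F ∣ H
    F∣H = ℤ∣.∣ᵤ⇒∣ f∣h
    F∣b : F ∣ b
    F∣b = ℤ∣.∣ᵤ⇒∣ f∣b
    F∣c : F ∣ c
    F∣c = ℤ∣.∣ᵤ⇒∣ f∣c
    F∣p : F ∣ p
    F∣p = subst (F ∣_) (sym p≡) (ℤ∣.∣n⇒∣m*n a₁ F∣H)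
    F∣q : F ∣ q
    F∣q = subst (F ∣_) (sym q≡) (ℤ∣.∣n⇒∣m*n a₂ F∣H)
    F∣r : F ∣ r
    F∣r = subst (F ∣_) (sym r≡) (ℤ∣.∣m∣n⇒∣m-n (ℤ∣.∣n⇒∣m*n a₁ F∣b) (ℤ∣.∣n⇒∣m*n y F∣c))
    F∣s : F ∣ s
    F∣s = subst (F ∣_) (sym s≡) (ℤ∣.∣m∣n⇒∣m+n (ℤ∣.∣n⇒∣m*n a₂ F∣b) (ℤ∣.∣n⇒∣m*n x F∣c))

  t : ℤ
  t = proj₁ (∃-coprime-shift h b c h≢0 gcd[h,b,c]≡1)

  X : ℤ
  X = b + c * t

  X⊥H : ℤC.Coprime X H
  X⊥H = proj₂ (∃-coprime-shift h b c h≢0 gcd[h,b,c]≡1)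

  HX∈Λ : (H , X) ∈Λ mat p q r s
  HX∈Λ = image (x - t * a₂ , y + t * a₁) (cong₂ _,_ H≡ X≡)
    where
    open ≡-Reasoning
    l₁ : ∀ a₁ a₂ H x y t → (a₁ * H) * (x - t * a₂) + (a₂ * H) * (y + t * a₁) ≡ H * (x * a₁ + y * a₂)
    l₁ = solve-∀
    H≡ : H ≡ p * (x - t * a₂) + q * (y + t * a₁)
    H≡ = sym (begin
      p * (x - t * a₂) + q * (y + t * a₁)                ≡⟨ cong₂ (λ p q → p * (x - t * a₂) + q * (y + t * a₁)) p≡ q≡ ⟩
      (a₁ * H) * (x - t * a₂) + (a₂ * H) * (y + t * a₁)  ≡⟨ l₁ a₁ a₂ H x y t ⟩
      H * (x * a₁ + y * a₂)                              ≡⟨ cong (H *_) xa₁+ya₂≡1 ⟩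
      H * 1ℤ                                             ≡⟨ ℤP.*-identityʳ H ⟩
      H                                                  ∎)
    X≡ : X ≡ r * (x - t * a₂) + s * (y + t * a₁)
    X≡ = l r s x y t a₁ a₂
      where
      l : ∀ r s x y t a₁ a₂ → (r * x + s * y) + (a₁ * s - a₂ * r) * t ≡ r * (x - t * a₂) + s * (y + t * a₁)
      l = solve-∀

d₁≡1⇒primitive-vector : ∀ M → det M ≢ 0ℤ → d₁ M ≡ 1 → ∃[ h ] ∃[ x ] ((h , x) ∈Λ M × ℤC.Coprime x h)
d₁≡1⇒primitive-vector (mat p q r s) D≢0 d₁≡1 = H , X , HX∈Λ , X⊥H
  where open PrimitiveVectorOfD₁≡1 p q r s D≢0 d₁≡1

primitive-vector⇒circulant : ∀ {M h x} → det M ≢ 0ℤ → (h , x) ∈Λ M → ℤC.Coprime x h → IsCirculant G⟨ M ,e₁,e₂⟩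
primitive-vector⇒circulant {M} {h} {x} D≢0 hx∈Λ x⊥h =
  ∣ det M ∣ , ℤ.≢-nonZero D≢0 , _ , PrimitiveVector.≅Cay hx∈Λ (trans (l x x₀ h y₀) (proj₂ (proj₂ (coprime-bézout {x} {h} x⊥h))))
  where
  x₀ y₀ : ℤ
  x₀ = proj₁ (coprime-bézout {x} {h} x⊥h)
  y₀ = proj₁ (proj₂ (coprime-bézout {x} {h} x⊥h))
  l : ∀ x x₀ h y₀ → x * x₀ + h * y₀ ≡ x₀ * x + y₀ * h
  l = solve-∀

even-or-odd : ∀ m → (+ 2 ∣ m) ⊎ (+ 2 ∣ m - 1ℤ)
even-or-odd m with m ℤ.%ℕ 2 | ℤ÷.n%ℕd<d m 2 | ℤ÷.a≡a%ℕn+[a/ℕn]*n m 2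
... | 0           | _                 | m≡ = inj₁ (divides (m ℤ./ℕ 2) (trans m≡ (ℤP.+-identityˡ _)))
... | 1           | _                 | m≡ = inj₂ (divides (m ℤ./ℕ 2) (trans (cong (_- 1ℤ) m≡) (l (m ℤ./ℕ 2 * + 2))))
  where
  l : ∀ n → (1ℤ + n) - 1ℤ ≡ n
  l = solve-∀
... | suc (suc _) | ℕ.s≤s (ℕ.s≤s ()) | _

∣∧<⇒≡0 : ∀ {g n} → g ℕD.∣ n → n ℕ.< g → n ≡ 0
∣∧<⇒≡0 {n = zero}  _   _   = refl
∣∧<⇒≡0 {n = suc _} g∣n n<g = ⊥-elim (ℕD.>⇒∤ n<g g∣n)

level : ℤ² → ℤ
level (a , b) = a + b

-- The digraph is the directed g-cycle with every vertex doubled, as is Cay(ℤ/2g, {1, 1 + g}).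
module DoubledCycle {M : Mat2} (g : ℕ) {{g-nonZero : ℕ.NonZero g}} (z : ℤ)
  (level-Λ : ∀ {d} → d ∈Λ M → + g ∣ level d)
  ([2,-2]∈Λ : (+ 2 , - + 2) ∈Λ M)
  ([1,-1]∉Λ : ¬ (1ℤ , - 1ℤ) ∈Λ M)
  ([G-z,z]∈Λ : (+ g - z , z) ∈Λ M) where

  G K : ℤ
  G = + g
  K = + (2 ℕ.* g)

  G∣K : G ∣ K
  G∣K = divides (+ 2) (ℤP.pos-* 2 g)

  Cay₂g : Digraph
  Cay₂g = Cay[ℤ/ 2 ℕ.* g , 1ℤ ∷ 1ℤ + G ∷ [] ]

  anti : ℤ → ℤ²
  anti m = (- m , m)

  even⇒anti∈Λ : ∀ {m} → + 2 ∣ m → anti m ∈Λ M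
  even⇒anti∈Λ {m} (divides j m≡j2) = Λ-cast (Λ-* (- j) [2,-2]∈Λ) (cong₂ _,_ (trans (l₁ j) (cong -_ (sym m≡j2))) (trans (l₂ j) (sym m≡j2)))
    where
    l₁ : ∀ j → - j * + 2 ≡ - (j * + 2)
    l₁ = solve-∀
    l₂ : ∀ j → - j * - + 2 ≡ j * + 2
    l₂ = solve-∀

  anti∈Λ⇒even : ∀ {m} → anti m ∈Λ M → + 2 ∣ m
  anti∈Λ⇒even {m} anti∈Λ with even-or-odd m
  ... | inj₁ even = even
  ... | inj₂ (divides j m-1≡j2) = ⊥-elim ([1,-1]∉Λ (Λ-cast (Λ-* (- 1ℤ) (Λ-+ anti∈Λ (Λ-* j [2,-2]∈Λ)))
                                      (cong₂ _,_ (c₁ (sym m-1≡j2)) (c₂ (sym m-1≡j2)))))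
    where
    c₁ : j * + 2 ≡ m - 1ℤ → - 1ℤ * (- m + j * + 2) ≡ 1ℤ
    c₁ eq = trans (l₁ m j) (trans (cong (λ x → m - x) eq) (l₂ m))
      where
      l₁ : ∀ m j → - 1ℤ * (- m + j * + 2) ≡ m - j * + 2
      l₁ = solve-∀
      l₂ : ∀ m → m - (m - 1ℤ) ≡ 1ℤ
      l₂ = solve-∀
    c₂ : j * + 2 ≡ m - 1ℤ → - 1ℤ * (m + j * - + 2) ≡ - 1ℤ
    c₂ eq = trans (l₁ m j) (trans (cong (λ x → - (m - x)) eq) (l₂ m))
      where
      l₁ : ∀ m j → - 1ℤ * (m + j * - + 2) ≡ - (m - j * + 2)
      l₁ = solve-∀
      l₂ : ∀ m → - (m - (m - 1ℤ)) ≡ - 1ℤ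
      l₂ = solve-∀

  -- A vector of level k G is k (G - z , z) plus an antidiagonal vector (- m , m).
  level-fibre : ∀ {d} → G ∣ level d → d ∈Λ M ⊎ d +² (1ℤ , - 1ℤ) ∈Λ M
  level-fibre {d₁ , d₂} (divides k level≡kG) with even-or-odd (d₂ - k * z)
  ... | inj₁ even = inj₁ (Λ-cast (Λ-+ (Λ-* k [G-z,z]∈Λ) (even⇒anti∈Λ even)) (cong₂ _,_ (d₁≡ level≡kG) (l₂ d₂ k z)))
    where
    d₁≡ : d₁ + d₂ ≡ k * G → k * (G - z) + - (d₂ - k * z) ≡ d₁
    d₁≡ eq = trans (l₁ k G z d₂) (trans (cong (_- d₂) (sym eq)) (l₃ d₁ d₂))
      where
      l₁ : ∀ k G z d₂ → k * (G - z) + - (d₂ - k * z) ≡ k * G - d₂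
      l₁ = solve-∀
      l₃ : ∀ d₁ d₂ → (d₁ + d₂) - d₂ ≡ d₁
      l₃ = solve-∀
    l₂ : ∀ d₂ k z → k * z + (d₂ - k * z) ≡ d₂
    l₂ = solve-∀
  ... | inj₂ odd = inj₂ (Λ-cast (Λ-+ (Λ-* k [G-z,z]∈Λ) (even⇒anti∈Λ odd)) (cong₂ _,_ (d₁≡ level≡kG) (l₂ d₂ k z)))
    where
    d₁≡ : d₁ + d₂ ≡ k * G → k * (G - z) + - (d₂ - k * z - 1ℤ) ≡ d₁ + 1ℤ
    d₁≡ eq = trans (l₁ k G z d₂) (trans (cong (λ x → x - d₂ + 1ℤ) (sym eq)) (l₃ d₁ d₂))
      where
      l₁ : ∀ k G z d₂ → k * (G - z) + - (d₂ - k * z - 1ℤ) ≡ k * G - d₂ + 1ℤ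
      l₁ = solve-∀
      l₃ : ∀ d₁ d₂ → (d₁ + d₂) - d₂ + 1ℤ ≡ d₁ + 1ℤ
      l₃ = solve-∀
    l₂ : ∀ d₂ k z → k * z + (d₂ - k * z - 1ℤ) ≡ d₂ + - 1ℤ
    l₂ = solve-∀

  rem : ℤ → ℕ
  rem j = j ℤ.%ℕ g

  quo : ℤ → ℤ
  quo j = j ℤ./ℕ g

  rem-quo : ∀ j → j ≡ + rem j + quo j * G
  rem-quo j = ℤ÷.a≡a%ℕn+[a/ℕn]*n j g

  rem<g : ∀ j → rem j ℕ.< g
  rem<g j = ℤ÷.n%ℕd<d j g

  rem-unique : ∀ {ρ ρ′} → ρ ℕ.< g → ρ′ ℕ.< g → G ∣ + ρ - + ρ′ → ρ ≡ ρ′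
  rem-unique {ρ} {ρ′} ρ<g ρ′<g G∣ρ-ρ′ =
    ℤP.+-injective (ℤP.i-j≡0⇒i≡j (+ ρ) (+ ρ′) (ℤP.∣i∣≡0⇒i≡0 (∣∧<⇒≡0 (ℤ∣.∣⇒∣ᵤ G∣ρ-ρ′) ∣ρ-ρ′∣<g)))
    where
    ∣ρ-ρ′∣<g : ∣ + ρ - + ρ′ ∣ ℕ.< g
    ∣ρ-ρ′∣<g = subst (ℕ._< g) (cong ∣_∣ (sym (ℤP.m-n≡m⊖n ρ ρ′))) (ℕP.≤-<-trans (ℤP.∣m⊝n∣≤m⊔n ρ ρ′) (ℕP.⊔-lub ρ<g ρ′<g))

  rem-quo-diff : ∀ j j′ → j - j′ ≡ (+ rem j - + rem j′) + (quo j - quo j′) * G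
  rem-quo-diff j j′ = trans (cong₂ _-_ (rem-quo j) (rem-quo j′)) (l (+ rem j) (+ rem j′) (quo j) (quo j′) G)
    where
    l : ∀ a b c d G → (a + c * G) - (b + d * G) ≡ (a - b) + (c - d) * G
    l = solve-∀

  divmod-unique : ∀ {j ρ k} → ρ ℕ.< g → j ≡ + ρ + k * G → rem j ≡ ρ × quo j ≡ k
  divmod-unique {j} {ρ} {k} ρ<g j≡ = rem≡ρ , ℤP.*-cancelʳ-≡ (quo j) k G (begin
    quo j * G                     ≡⟨ l (+ ρ) (quo j * G) ⟨
    (+ ρ + quo j * G) - + ρ       ≡⟨ cong (λ x → (+ x + quo j * G) - + ρ) rem≡ρ ⟨
    (+ rem j + quo j * G) - + ρ   ≡⟨ cong (_- + ρ) (rem-quo j) ⟨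
    j - + ρ                       ≡⟨ cong (_- + ρ) j≡ ⟩
    (+ ρ + k * G) - + ρ           ≡⟨ l (+ ρ) (k * G) ⟩
    k * G                         ∎)
    where
    open ≡-Reasoning
    l : ∀ a x → (a + x) - a ≡ x
    l = solve-∀
    l₂ : ∀ a b c d G → a - b ≡ ((a + c * G) - (b + d * G)) + (d - c) * G
    l₂ = solve-∀
    rem≡ρ : rem j ≡ ρ
    rem≡ρ = rem-unique (rem<g j) ρ<g (divides (k - quo j) (begin
      + rem j - + ρ                                                ≡⟨ l₂ (+ rem j) (+ ρ) (quo j) k G ⟩
      ((+ rem j + quo j * G) - (+ ρ + k * G)) + (k - quo j) * G    ≡⟨ cong (λ x → (x - (+ ρ + k * G)) + (k - quo j) * G) (trans (sym (rem-quo j)) j≡) ⟩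
      ((+ ρ + k * G) - (+ ρ + k * G)) + (k - quo j) * G            ≡⟨ l₃ (+ ρ + k * G) ((k - quo j) * G) ⟩
      (k - quo j) * G                                              ∎))
      where
      l₃ : ∀ a b → (a - a) + b ≡ b
      l₃ = solve-∀

  ≡modK⇒ : ∀ {j j′} → j ≡ j′ [mod K ] → rem j ≡ rem j′ × + 2 ∣ quo j - quo j′
  ≡modK⇒ {j} {j′} (mod K∣j-j′) = rem≡ , ℤ∣.*-cancelʳ-∣ G (subst (_∣ (quo j - quo j′) * G) (ℤP.pos-* 2 g) (subst (K ∣_) j-j′≡ K∣j-j′))
    where
    G∣j-j′ : G ∣ j - j′
    G∣j-j′ = ℤ∣.∣-trans G∣K K∣j-j′
    rem≡ : rem j ≡ rem j′
    rem≡ = rem-unique (rem<g j) (rem<g j′)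
      (ℤ∣.∣m+n∣n⇒∣m (subst (G ∣_) (rem-quo-diff j j′) G∣j-j′) (ℤ∣.∣n⇒∣m*n (quo j - quo j′) ℤ∣.∣-refl))
    j-j′≡ : j - j′ ≡ (quo j - quo j′) * G
    j-j′≡ = trans (rem-quo-diff j j′) (trans (cong (λ ρ → (+ ρ - + rem j′) + (quo j - quo j′) * G) rem≡) (l (+ rem j′) ((quo j - quo j′) * G)))
      where
      l : ∀ a b → (a - a) + b ≡ b
      l = solve-∀

  ≡modK⇐ : ∀ {j j′} → rem j ≡ rem j′ → + 2 ∣ quo j - quo j′ → j ≡ j′ [mod K ]
  ≡modK⇐ {j} {j′} rem≡ (divides i quo-diff≡) = mod (divides i (begin
    j - j′                                        ≡⟨ rem-quo-diff j j′ ⟩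
    (+ rem j - + rem j′) + (quo j - quo j′) * G   ≡⟨ cong₂ (λ ρ x → (+ ρ - + rem j′) + x * G) rem≡ quo-diff≡ ⟩
    (+ rem j′ - + rem j′) + (i * + 2) * G         ≡⟨ l (+ rem j′) i G ⟩
    i * (+ 2 * G)                                 ≡⟨ cong (i *_) (ℤP.pos-* 2 g) ⟨
    i * K                                         ∎))
    where
    open ≡-Reasoning
    l : ∀ a i G → (a - a) + (i * + 2) * G ≡ i * (+ 2 * G)
    l = solve-∀

  -- The representative of j = ρ + k g: the point of level ρ with second coordinate k.
  ψ : ℤ → ℤ²
  ψ j = (+ rem j - quo j , quo j)

  ψ-diff : ∀ j j′ → rem j ≡ rem j′ → ψ j -² ψ j′ ≡ anti (quo j - quo j′)
  ψ-diff j j′ rem≡ = cong₂ _,_ (trans (cong (λ ρ → (+ ρ - quo j) - (+ rem j′ - quo j′)) rem≡) (l (+ rem j′) (quo j) (quo j′))) refl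
    where
    l : ∀ ρ k k′ → (ρ - k) - (ρ - k′) ≡ - (k - k′)
    l = solve-∀

  ψ-cong : ∀ {j j′} → j ≡ j′ [mod K ] → ψ j ≡² ψ j′ [mod M ]
  ψ-cong {j} {j′} j≡j′ = ≡²-by (even⇒anti∈Λ (proj₂ (≡modK⇒ j≡j′))) (sym (ψ-diff j j′ (proj₁ (≡modK⇒ j≡j′))))

  ψ-injective : ∀ {j j′} → ψ j ≡² ψ j′ [mod M ] → j ≡ j′ [mod K ]
  ψ-injective {j} {j′} (mod² d∈Λ) = ≡modK⇐ rem≡ (anti∈Λ⇒even (Λ-cast d∈Λ (ψ-diff j j′ rem≡)))
    where
    l : ∀ ρ ρ′ k k′ → ((ρ - k) - (ρ′ - k′)) + (k - k′) ≡ ρ - ρ′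
    l = solve-∀
    rem≡ : rem j ≡ rem j′
    rem≡ = rem-unique (rem<g j) (rem<g j′) (subst (G ∣_) (l (+ rem j) (+ rem j′) (quo j) (quo j′)) (level-Λ d∈Λ))

  φ : ℤ² → ℤ
  φ u = + rem (level u) + G * (proj₂ u - quo (level u) * z)

  φ-divmod : ∀ u → rem (φ u) ≡ rem (level u) × quo (φ u) ≡ proj₂ u - quo (level u) * z
  φ-divmod u = divmod-unique (rem<g (level u)) (cong (λ x → + rem (level u) + x) (ℤP.*-comm G (proj₂ u - quo (level u) * z)))

  -- u - ψ (φ u) = quo (level u) (G - z , z)
  ψ∘φ : ∀ u → ψ (φ u) ≡² u [mod M ]
  ψ∘φ (a , b) = ≡²-sym (≡²-by (Λ-* k [G-z,z]∈Λ) (cong₂ _,_ c₁ c₂))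
    where
    open ≡-Reasoning
    k : ℤ
    k = quo (a + b)
    ρ : ℕ
    ρ = rem (a + b)
    rem≡ : rem (φ (a , b)) ≡ ρ
    rem≡ = proj₁ (φ-divmod (a , b))
    quo≡ : quo (φ (a , b)) ≡ b - k * z
    quo≡ = proj₂ (φ-divmod (a , b))
    c₁ : k * (G - z) ≡ a - (+ rem (φ (a , b)) - quo (φ (a , b)))
    c₁ = begin
      k * (G - z)                                    ≡⟨ l₁ (+ ρ) k G b z ⟩
      ((+ ρ + k * G) - b) - (+ ρ - (b - k * z))      ≡⟨ cong (λ x → (x - b) - (+ ρ - (b - k * z))) (rem-quo (a + b)) ⟨
      ((a + b) - b) - (+ ρ - (b - k * z))            ≡⟨ l₂ a b (+ ρ - (b - k * z)) ⟩
      a - (+ ρ - (b - k * z))                        ≡⟨ cong₂ (λ ρ′ k′ → a - (+ ρ′ - k′)) rem≡ quo≡ ⟨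
      a - (+ rem (φ (a , b)) - quo (φ (a , b)))      ∎
      where
      l₁ : ∀ ρ k G b z → k * (G - z) ≡ ((ρ + k * G) - b) - (ρ - (b - k * z))
      l₁ = solve-∀
      l₂ : ∀ a b c → ((a + b) - b) - c ≡ a - c
      l₂ = solve-∀
    c₂ : k * z ≡ b - quo (φ (a , b))
    c₂ = trans (l₂ b k z) (cong (λ x → b - x) (sym quo≡))
      where
      l₂ : ∀ b k z → k * z ≡ b - (b - k * z)
      l₂ = solve-∀

  φ∘ψ : ∀ j → φ (ψ j) ≡ j
  φ∘ψ j = begin
    + rem (level (ψ j)) + G * (quo j - quo (level (ψ j)) * z)  ≡⟨ cong₂ (λ ρ k → + ρ + G * (quo j - k * z)) rem≡ quo≡ ⟩
    + rem j + G * (quo j - 0ℤ * z)                             ≡⟨ l₂ (+ rem j) G (quo j) z ⟩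
    + rem j + quo j * G                                        ≡⟨ rem-quo j ⟨
    j                                                          ∎
    where
    open ≡-Reasoning
    l₁ : ∀ ρ k G → (ρ - k) + k ≡ ρ + 0ℤ * G
    l₁ = solve-∀
    l₂ : ∀ ρ G k z → ρ + G * (k - 0ℤ * z) ≡ ρ + k * G
    l₂ = solve-∀
    rem≡ : rem (level (ψ j)) ≡ rem j
    rem≡ = proj₁ (divmod-unique {level (ψ j)} {rem j} {0ℤ} (rem<g j) (l₁ (+ rem j) (quo j) G))
    quo≡ : quo (level (ψ j)) ≡ 0ℤ
    quo≡ = proj₂ (divmod-unique {level (ψ j)} {rem j} {0ℤ} (rem<g j) (l₁ (+ rem j) (quo j) G))

  φ-cong : ∀ {u v} → u ≡² v [mod M ] → φ u ≡ φ v [mod K ]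
  φ-cong {u} {v} u≡v = ψ-injective (≡²-trans (ψ∘φ u) (≡²-trans u≡v (≡²-sym (ψ∘φ v))))

  level≡φ : ∀ u → level u ≡ φ u [mod G ]
  level≡φ u = mod (divides (quo (level u) - N) (begin
    level u - φ u                                       ≡⟨ cong (_- φ u) (rem-quo (level u)) ⟩
    (+ rem (level u) + quo (level u) * G) - φ u         ≡⟨ l (+ rem (level u)) (quo (level u)) G N ⟩
    (quo (level u) - N) * G                             ∎))
    where
    open ≡-Reasoning
    N : ℤ
    N = proj₂ u - quo (level u) * z
    l : ∀ ρ k G N → (ρ + k * G) - (ρ + G * N) ≡ (k - N) * G
    l = solve-∀

  arc⇔level-step : ∀ u v → Digraph.Arc G⟨ M ,e₁,e₂⟩ u v ⇔ level v ≡ level u + 1ℤ [mod G ]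
  arc⇔level-step (u₁ , u₂) (v₁ , v₂) = mk⇔ to from
    where
    l₁ : ∀ u₁ u₂ v₁ v₂ → (v₁ - (u₁ + 1ℤ)) + (v₂ - (u₂ + 0ℤ)) ≡ (v₁ + v₂) - ((u₁ + u₂) + 1ℤ)
    l₁ = solve-∀
    l₂ : ∀ u₁ u₂ v₁ v₂ → (v₁ - (u₁ + 0ℤ)) + (v₂ - (u₂ + 1ℤ)) ≡ (v₁ + v₂) - ((u₁ + u₂) + 1ℤ)
    l₂ = solve-∀
    l₃ : ∀ u₁ v₁ → (v₁ - (u₁ + 1ℤ)) + 1ℤ ≡ v₁ - (u₁ + 0ℤ)
    l₃ = solve-∀
    l₄ : ∀ u₂ v₂ → (v₂ - (u₂ + 0ℤ)) + - 1ℤ ≡ v₂ - (u₂ + 1ℤ)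
    l₄ = solve-∀
    to : Digraph.Arc G⟨ M ,e₁,e₂⟩ (u₁ , u₂) (v₁ , v₂) → v₁ + v₂ ≡ (u₁ + u₂) + 1ℤ [mod G ]
    to (inj₁ (w , eq)) = mod (subst (G ∣_) (l₁ u₁ u₂ v₁ v₂) (level-Λ (image w eq)))
    to (inj₂ (w , eq)) = mod (subst (G ∣_) (l₂ u₁ u₂ v₁ v₂) (level-Λ (image w eq)))
    from : v₁ + v₂ ≡ (u₁ + u₂) + 1ℤ [mod G ] → Digraph.Arc G⟨ M ,e₁,e₂⟩ (u₁ , u₂) (v₁ , v₂)
    from (mod G∣) = [ (λ d∈Λ → inj₁ (Λ⇒≡[] (v₁ , v₂) ((u₁ , u₂) +² e₁) d∈Λ))
                    , (λ d′∈Λ → inj₂ (Λ⇒≡[] (v₁ , v₂) ((u₁ , u₂) +² e₂) (Λ-cast d′∈Λ (cong₂ _,_ (l₃ u₁ v₁) (l₄ u₂ v₂))))) ]′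
                    (level-fibre {(v₁ , v₂) -² ((u₁ , u₂) +² e₁)} (subst (G ∣_) (sym (l₁ u₁ u₂ v₁ v₂)) G∣))

  Cay-arc⇔step : ∀ j k → Digraph.Arc Cay₂g j k ⇔ k ≡ j + 1ℤ [mod G ]
  Cay-arc⇔step j k = mk⇔ to from
    where
    l₁ : ∀ j k G → (k - (j + (1ℤ + G))) + G ≡ k - (j + 1ℤ)
    l₁ = solve-∀
    to : Digraph.Arc Cay₂g j k → k ≡ j + 1ℤ [mod G ]
    to (_ , here refl , K∣) = mod (ℤ∣.∣-trans G∣K (ℤ∣.∣ᵤ⇒∣ {K} {k - (j + 1ℤ)} K∣))
    to (_ , there (here refl) , K∣) =
      mod (subst (G ∣_) (l₁ j k G) (ℤ∣.∣m∣n⇒∣m+n (ℤ∣.∣-trans G∣K (ℤ∣.∣ᵤ⇒∣ {K} {k - (j + (1ℤ + G))} K∣)) ℤ∣.∣-refl))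
    from : k ≡ j + 1ℤ [mod G ] → Digraph.Arc Cay₂g j k
    from (mod (divides J k-[j+1]≡JG)) = [ even , odd ]′ (even-or-odd J)
      where
      open ≡-Reasoning
      l₂ : ∀ i G → (i * + 2) * G ≡ i * (+ 2 * G)
      l₂ = solve-∀
      l₃ : ∀ j k G → k - (j + (1ℤ + G)) ≡ (k - (j + 1ℤ)) - G
      l₃ = solve-∀
      l₄ : ∀ J G → J * G - G ≡ (J - 1ℤ) * G
      l₄ = solve-∀
      even : + 2 ∣ J → Digraph.Arc Cay₂g j k
      even (divides i J≡) = 1ℤ , here refl , ℤ∣.∣⇒∣ᵤ (divides i (begin
        k - (j + 1ℤ)        ≡⟨ k-[j+1]≡JG ⟩
        J * G               ≡⟨ cong (_* G) J≡ ⟩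
        (i * + 2) * G       ≡⟨ l₂ i G ⟩
        i * (+ 2 * G)       ≡⟨ cong (i *_) (ℤP.pos-* 2 g) ⟨
        i * K               ∎))
      odd : + 2 ∣ J - 1ℤ → Digraph.Arc Cay₂g j k
      odd (divides i J-1≡) = 1ℤ + G , there (here refl) , ℤ∣.∣⇒∣ᵤ (divides i (begin
        k - (j + (1ℤ + G))  ≡⟨ l₃ j k G ⟩
        (k - (j + 1ℤ)) - G  ≡⟨ cong (_- G) k-[j+1]≡JG ⟩
        J * G - G           ≡⟨ l₄ J G ⟩
        (J - 1ℤ) * G        ≡⟨ cong (_* G) J-1≡ ⟩
        (i * + 2) * G       ≡⟨ l₂ i G ⟩
        i * (+ 2 * G)       ≡⟨ cong (i *_) (ℤP.pos-* 2 g) ⟨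
        i * K               ∎))

  level-step⇔φ-step : ∀ u v → level v ≡ level u + 1ℤ [mod G ] ⇔ φ v ≡ φ u + 1ℤ [mod G ]
  level-step⇔φ-step u v = mk⇔
    (λ step → ≡ₘ-trans (≡ₘ-sym (level≡φ v)) (≡ₘ-trans step (+-congʳₘ 1ℤ (level≡φ u))))
    (λ step → ≡ₘ-trans (level≡φ v) (≡ₘ-trans step (+-congʳₘ 1ℤ (≡ₘ-sym (level≡φ u)))))

  ≅Cay : G⟨ M ,e₁,e₂⟩ ≅ Cay₂g
  ≅Cay = record
    { to        = φ
    ; from      = ψ
    ; to-cong   = λ {u} {v} u≡v → ≡ₘ⇒∣ᵤ (φ-cong (≡[]⇒≡² {M} {u} {v} u≡v))
    ; from-cong = λ {j} {j′} j≡j′ → ≡²⇒≡[] (ψ-cong (∣ᵤ⇒≡ₘ {K} {j} {j′} j≡j′))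
    ; from∘to   = λ u → ≡²⇒≡[] (ψ∘φ u)
    ; to∘from   = λ j → ≡ₘ⇒∣ᵤ {K} (≡⇒≡ₘ (φ∘ψ j))
    ; arc       = λ u v → ⇔-sym (Cay-arc⇔step (φ u) (φ v)) ⇔-∘ (level-step⇔φ-step u v ⇔-∘ arc⇔level-step u v)
    }

module DoubledCycleHypotheses (p q r s : ℤ) (D≢0 : p * s - q * r ≢ 0ℤ)
  (m≡2g : ∣ p * s - q * r ∣ ≡ 2 ℕ.* gcd (gcd ∣ p * s - q * r ∣ ∣ s + q ∣) ∣ p + r ∣) where

  M : Mat2
  M = mat p q r s

  D P Q : ℤ
  D = p * s - q * r
  P = p + r
  Q = s + q

  g : ℕ
  g = gcd (gcd ∣ D ∣ ∣ Q ∣) ∣ P ∣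

  G K : ℤ
  G = + g
  K = + (2 ℕ.* g)

  g≢0 : g ≢ 0
  g≢0 g≡0 = D≢0 (ℤP.∣i∣≡0⇒i≡0 (trans m≡2g (cong (2 ℕ.*_) g≡0)))

  instance
    g-nonZero : ℕ.NonZero g
    g-nonZero = ℕ.≢-nonZero g≢0

  G∣Q : G ∣ Q
  G∣Q = ℤ∣.∣ᵤ⇒∣ (ℕD.∣-trans (gcd[m,n]∣m (gcd ∣ D ∣ ∣ Q ∣) ∣ P ∣) (gcd[m,n]∣n ∣ D ∣ ∣ Q ∣))

  G∣P : G ∣ P
  G∣P = ℤ∣.∣ᵤ⇒∣ (gcd[m,n]∣n (gcd ∣ D ∣ ∣ Q ∣) ∣ P ∣)

  K∣⇒D∣ : ∀ {z} → K ∣ z → D ∣ z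
  K∣⇒D∣ K∣z = ℤ∣.∣ᵤ⇒∣ (subst (ℕD._∣ _) (sym m≡2g) (ℤ∣.∣⇒∣ᵤ K∣z))

  level-Λ : ∀ {d} → d ∈Λ M → G ∣ level d
  level-Λ (image (w₁ , w₂) refl) =
    subst (G ∣_) (l p q r s w₁ w₂) (ℤ∣.∣m∣n⇒∣m+n (ℤ∣.∣n⇒∣m*n w₁ G∣P) (ℤ∣.∣n⇒∣m*n w₂ G∣Q))
    where
    l : ∀ p q r s w₁ w₂ → w₁ * (p + r) + w₂ * (s + q) ≡ (p * w₁ + q * w₂) + (r * w₁ + s * w₂)
    l = solve-∀

  [2,-2]∈Λ : (+ 2 , - + 2) ∈Λ M
  [2,-2]∈Λ = det∣adj⇒Λ D≢0 (K∣⇒D∣ (subst (K ∣_) (l₁ s q) (*2 G∣Q)) , K∣⇒D∣ (subst (K ∣_) (l₂ p r) (ℤ∣.∣m⇒∣-m (*2 G∣P))))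
    where
    *2 : ∀ {z} → G ∣ z → K ∣ + 2 * z
    *2 G∣z = subst (_∣ _) (sym (ℤP.pos-* 2 g)) (ℤ∣.*-monoʳ-∣ (+ 2) G∣z)
    l₁ : ∀ s q → + 2 * (s + q) ≡ s * + 2 - q * - + 2
    l₁ = solve-∀
    l₂ : ∀ p r → - (+ 2 * (p + r)) ≡ p * - + 2 - r * + 2
    l₂ = solve-∀

  [1,-1]∉Λ : ¬ (1ℤ , - 1ℤ) ∈Λ M
  [1,-1]∉Λ [1,-1]∈Λ = ℕP.<⇒≱ (ℕP.m<m*n g 2 (ℕ.s≤s (ℕ.s≤s ℕ.z≤n)))
                       (subst (ℕ._≤ g) (trans m≡2g (ℕP.*-comm 2 g)) (ℕD.∣⇒≤ ∣D∣∣g))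
    where
    D∣Q : D ∣ Q
    D∣Q = subst (D ∣_) (l₁ s q) (proj₁ (Λ⇒det∣adj [1,-1]∈Λ))
      where
      l₁ : ∀ s q → s * + 1 - q * - + 1 ≡ s + q
      l₁ = solve-∀
    D∣-P : D ∣ - P
    D∣-P = subst (D ∣_) (l₂ p r) (proj₂ (Λ⇒det∣adj [1,-1]∈Λ))
      where
      l₂ : ∀ p r → p * - + 1 - r * + 1 ≡ - (p + r)
      l₂ = solve-∀
    ∣D∣∣g : ∣ D ∣ ℕD.∣ g
    ∣D∣∣g = gcd-greatest (gcd-greatest ℕD.∣-refl (ℤ∣.∣⇒∣ᵤ D∣Q)) (subst (∣ D ∣ ℕD.∣_) (ℤP.∣-i∣≡∣i∣ P) (ℤ∣.∣⇒∣ᵤ D∣-P))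

  x₁ y₁ x₂ y₂ : ℤ
  x₁ = proj₁ (bézout D Q)
  y₁ = proj₁ (proj₂ (bézout D Q))
  x₂ = proj₁ (bézout (+ gcd ∣ D ∣ ∣ Q ∣) P)
  y₂ = proj₁ (proj₂ (bézout (+ gcd ∣ D ∣ ∣ Q ∣) P))

  -- G = x₂ (x₁ D + y₁ Q) + y₂ P, and D = s P - r Q.
  w₁ w₂ : ℤ
  w₁ = x₂ * x₁ * s + y₂
  w₂ = x₂ * y₁ - x₂ * x₁ * r

  level-Mw : (p * w₁ + q * w₂) + (r * w₁ + s * w₂) ≡ G
  level-Mw = trans (l p q r s x₁ y₁ x₂ y₂)
               (trans (cong (λ d → x₂ * d + y₂ * P) (proj₂ (proj₂ (bézout D Q)))) (proj₂ (proj₂ (bézout (+ gcd ∣ D ∣ ∣ Q ∣) P))))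
    where
    l : ∀ p q r s x₁ y₁ x₂ y₂ →
         (p * (x₂ * x₁ * s + y₂) + q * (x₂ * y₁ - x₂ * x₁ * r)) + (r * (x₂ * x₁ * s + y₂) + s * (x₂ * y₁ - x₂ * x₁ * r))
         ≡ x₂ * (x₁ * (p * s - q * r) + y₁ * (s + q)) + y₂ * (p + r)
    l = solve-∀

  ∃[G-z,z]∈Λ : ∃[ z ] ((G - z , z) ∈Λ M)
  ∃[G-z,z]∈Λ = r * w₁ + s * w₂ , image (w₁ , w₂) (cong₂ _,_ (trans (cong (_- (r * w₁ + s * w₂)) (sym level-Mw)) (l (p * w₁ + q * w₂) (r * w₁ + s * w₂))) refl)
    where
    l : ∀ a z → (a + z) - z ≡ a
    l = solve-∀

m≡2g⇒circulant : ∀ M → det M ≢ 0ℤ →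
  ∣ det M ∣ ≡ 2 ℕ.* gcd (gcd ∣ det M ∣ ∣ m22 M + m12 M ∣) ∣ m11 M + m21 M ∣ → IsCirculant G⟨ M ,e₁,e₂⟩
m≡2g⇒circulant (mat p q r s) D≢0 m≡2g =
  2 ℕ.* g , ℕP.m*n≢0 2 g , _ , DoubledCycle.≅Cay g (proj₁ ∃[G-z,z]∈Λ) level-Λ [2,-2]∈Λ [1,-1]∉Λ (proj₂ ∃[G-z,z]∈Λ)
  where open DoubledCycleHypotheses p q r s D≢0 m≡2g

ℤ-induction : (Q : ℤ → Set) → Q 0ℤ → (∀ k → Q k ⇔ Q (k + 1ℤ)) → ∀ k → Q k
ℤ-induction Q Q0 step (+ n) = up n
  where
  up : ∀ n → Q (+ n)
  up zero    = Q0
  up (suc n) = subst Q (cong +_ (ℕP.+-comm n 1)) (Equivalence.to (step (+ n)) (up n))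
ℤ-induction Q Q0 step -[1+ n ] = down n
  where
  down : ∀ n → Q -[1+ n ]
  down zero    = Equivalence.from (step -[1+ 0 ]) Q0
  down (suc n) = Equivalence.from (step -[1+ suc n ]) (down n)

ℤ²-induction : (Q : ℤ² → Set) → Q (0ℤ , 0ℤ) → (∀ u → Q u ⇔ Q (u +² e₁)) → (∀ u → Q u ⇔ Q (u +² e₂)) → ∀ u → Q u
ℤ²-induction Q Q0 step₁ step₂ (a , b) = ℤ-induction (λ b → Q (a , b)) (ℤ-induction (λ a → Q (a , 0ℤ)) Q0 (λ a → step₁ (a , 0ℤ)) a)
  (λ b → subst (λ x → Q (a , b) ⇔ Q (x , b + 1ℤ)) (ℤP.+-identityʳ a) (step₂ (a , b))) b

-- If the two out-neighbours of a vertex are always distinct, and so are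
-- the candidates u + 2e₁, u + e₁ + e₂, u + 2e₂ for the vertex two steps ahead, then φ is affine.
module CirculantLabelling {M : Mat2} {n : ℕ} {B : List ℤ} (iso : G⟨ M ,e₁,e₂⟩ ≅ Cay[ℤ/ n , B ])
  ([1,-1]∉Λ : ¬ (1ℤ , - 1ℤ) ∈Λ M) ([2,-2]∉Λ : ¬ (+ 2 , - + 2) ∈Λ M) where

  private module I = _≅_ iso

  N : ℤ
  N = + n

  φ : ℤ² → ℤ
  φ = I.to

  ψ : ℤ → ℤ²
  ψ = I.from

  o : ℤ²
  o = (0ℤ , 0ℤ)

  φ-cong : ∀ {u v} → u ≡² v [mod M ] → φ u ≡ φ v [mod N ]
  φ-cong {u} {v} u≡v = ∣ᵤ⇒≡ₘ (I.to-cong {u} {v} (≡²⇒≡[] u≡v))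

  ψ∘φ : ∀ u → ψ (φ u) ≡² u [mod M ]
  ψ∘φ u = ≡[]⇒≡² {M} {ψ (φ u)} {u} (I.from∘to u)

  φ-injective : ∀ {u v} → φ u ≡ φ v [mod N ] → u ≡² v [mod M ]
  φ-injective {u} {v} φu≡φv =
    ≡²-trans (≡²-sym (ψ∘φ u)) (≡²-trans (≡[]⇒≡² {M} {ψ (φ u)} {ψ (φ v)} (I.from-cong (≡ₘ⇒∣ᵤ φu≡φv))) (ψ∘φ v))

  φ∘ψ : ∀ j → φ (ψ j) ≡ j [mod N ]
  φ∘ψ j = ∣ᵤ⇒≡ₘ (I.to∘from j)

  arc-to : ∀ {u v} → Digraph.Arc G⟨ M ,e₁,e₂⟩ u v → ∃[ β ] (β ∈ B × φ v ≡ φ u + β [mod N ])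
  arc-to {u} {v} arc = let β , β∈B , N∣ = Equivalence.to (I.arc u v) arc in β , β∈B , ∣ᵤ⇒≡ₘ N∣

  arc-from : ∀ {u v β} → β ∈ B → φ v ≡ φ u + β [mod N ] → Digraph.Arc G⟨ M ,e₁,e₂⟩ u v
  arc-from {u} {v} {β} β∈B φv≡ = Equivalence.from (I.arc u v) (β , β∈B , ≡ₘ⇒∣ᵤ φv≡)

  IsStep : ℤ → Set
  IsStep β = ∃[ b ] (b ∈ B × β ≡ b [mod N ])

  successor : ∀ u {β y} → IsStep β → y ≡ φ u + β [mod N ] → y ≡ φ (u +² e₁) [mod N ] ⊎ y ≡ φ (u +² e₂) [mod N ]
  successor u {β} {y} (b , b∈B , β≡b) y≡ =
    Sum.map (λ arc → ≡ₘ-trans (≡ₘ-sym (φ∘ψ y)) (φ-cong (≡[]⇒≡² {M} {ψ y} {u +² e₁} arc)))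
            (λ arc → ≡ₘ-trans (≡ₘ-sym (φ∘ψ y)) (φ-cong (≡[]⇒≡² {M} {ψ y} {u +² e₂} arc)))
            (arc-from {u} {ψ y} b∈B (≡ₘ-trans (φ∘ψ y) (≡ₘ-trans y≡ (+-congˡₘ (φ u) β≡b))))

  s t : ℤ
  s = φ e₁ - φ o
  t = φ e₂ - φ o

  step⇒s-or-t : ∀ {β} → IsStep β → β ≡ s [mod N ] ⊎ β ≡ t [mod N ]
  step⇒s-or-t {β} step = Sum.map (≡ₘ-by (l (φ o) β (φ e₁))) (≡ₘ-by (l (φ o) β (φ e₂))) (successor o step ≡ₘ-refl)
    where
    l : ∀ a β b → (a + β) - b ≡ β - (b - a)
    l = solve-∀

  step-s : IsStep s
  step-s = let β , β∈B , φe₁≡ = arc-to {o} {e₁} (inj₁ (≡[]-refl {M} e₁)) in β , β∈B , ≡ₘ-by (l (φ e₁) (φ o) β) φe₁≡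
    where
    l : ∀ a b β → a - (b + β) ≡ (a - b) - β
    l = solve-∀

  step-t : IsStep t
  step-t = let β , β∈B , φe₂≡ = arc-to {o} {e₂} (inj₂ (≡[]-refl {M} e₂)) in β , β∈B , ≡ₘ-by (l (φ e₂) (φ o) β) φe₂≡
    where
    l : ∀ a b β → a - (b + β) ≡ (a - b) - β
    l = solve-∀

  e₁≢e₂ : ∀ u → ¬ u +² e₁ ≡² u +² e₂ [mod M ]
  e₁≢e₂ (a , b) = ≢-by-difference [1,-1]∉Λ (cong₂ _,_ (l₁ a) (l₂ b))
    where
    l₁ : ∀ a → (a + 1ℤ) - (a + 0ℤ) ≡ 1ℤ
    l₁ = solve-∀
    l₂ : ∀ b → (b + 0ℤ) - (b + 1ℤ) ≡ - 1ℤ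
    l₂ = solve-∀

  2e₁≢e₂+e₁ : ∀ u → ¬ (u +² e₁) +² e₁ ≡² (u +² e₂) +² e₁ [mod M ]
  2e₁≢e₂+e₁ (a , b) = ≢-by-difference [1,-1]∉Λ (cong₂ _,_ (l₁ a) (l₂ b))
    where
    l₁ : ∀ a → ((a + 1ℤ) + 1ℤ) - ((a + 0ℤ) + 1ℤ) ≡ 1ℤ
    l₁ = solve-∀
    l₂ : ∀ b → ((b + 0ℤ) + 0ℤ) - ((b + 1ℤ) + 0ℤ) ≡ - 1ℤ
    l₂ = solve-∀

  2e₁≢2e₂ : ∀ u → ¬ (u +² e₁) +² e₁ ≡² (u +² e₂) +² e₂ [mod M ]
  2e₁≢2e₂ (a , b) = ≢-by-difference [2,-2]∉Λ (cong₂ _,_ (l₁ a) (l₂ b))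
    where
    l₁ : ∀ a → ((a + 1ℤ) + 1ℤ) - ((a + 0ℤ) + 0ℤ) ≡ + 2
    l₁ = solve-∀
    l₂ : ∀ b → ((b + 0ℤ) + 0ℤ) - ((b + 1ℤ) + 1ℤ) ≡ - + 2
    l₂ = solve-∀

  e₂+e₁≡e₁+e₂ : ∀ u → (u +² e₂) +² e₁ ≡² (u +² e₁) +² e₂ [mod M ]
  e₂+e₁≡e₁+e₂ (a , b) = ≡⇒≡² (cong₂ _,_ (l₁ a) (l₂ b))
    where
    l₁ : ∀ a → (a + 0ℤ) + 1ℤ ≡ (a + 1ℤ) + 0ℤ
    l₁ = solve-∀
    l₂ : ∀ b → (b + 1ℤ) + 0ℤ ≡ (b + 0ℤ) + 1ℤ
    l₂ = solve-∀

  s≢t : ¬ s ≡ t [mod N ]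
  s≢t s≡t = e₁≢e₂ o (φ-injective (≡ₘ-by (l (φ e₁) (φ e₂) (φ o)) s≡t))
    where
    l : ∀ a b c → (a - c) - (b - c) ≡ a - b
    l = solve-∀

  Oriented : ℤ → ℤ → ℤ² → Set
  Oriented s′ t′ u = φ (u +² e₁) ≡ φ u + s′ [mod N ] × φ (u +² e₂) ≡ φ u + t′ [mod N ]

  oriented : ∀ u → Oriented s t u ⊎ Oriented t s u
  oriented u = orient (step⇒s-or-t (β₁ , β₁∈B , ≡ₘ-refl)) (step⇒s-or-t (β₂ , β₂∈B , ≡ₘ-refl))
    where
    arc₁ : ∃[ β ] (β ∈ B × φ (u +² e₁) ≡ φ u + β [mod N ])
    arc₁ = arc-to {u} {u +² e₁} (inj₁ (≡[]-refl {M} (u +² e₁)))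
    arc₂ : ∃[ β ] (β ∈ B × φ (u +² e₂) ≡ φ u + β [mod N ])
    arc₂ = arc-to {u} {u +² e₂} (inj₂ (≡[]-refl {M} (u +² e₂)))
    β₁ β₂ : ℤ
    β₁ = proj₁ arc₁
    β₂ = proj₁ arc₂
    β₁∈B : β₁ ∈ B
    β₁∈B = proj₁ (proj₂ arc₁)
    β₂∈B : β₂ ∈ B
    β₂∈B = proj₁ (proj₂ arc₂)
    φ₁ : φ (u +² e₁) ≡ φ u + β₁ [mod N ]
    φ₁ = proj₂ (proj₂ arc₁)
    φ₂ : φ (u +² e₂) ≡ φ u + β₂ [mod N ]
    φ₂ = proj₂ (proj₂ arc₂)
    collide : ∀ {c} → β₁ ≡ c [mod N ] → β₂ ≡ c [mod N ] → ⊥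
    collide β₁≡c β₂≡c = e₁≢e₂ u (φ-injective
      (≡ₘ-trans φ₁ (≡ₘ-trans (+-congˡₘ (φ u) (≡ₘ-trans β₁≡c (≡ₘ-sym β₂≡c))) (≡ₘ-sym φ₂))))
    orient : β₁ ≡ s [mod N ] ⊎ β₁ ≡ t [mod N ] → β₂ ≡ s [mod N ] ⊎ β₂ ≡ t [mod N ] → Oriented s t u ⊎ Oriented t s u
    orient (inj₁ β₁≡s) (inj₁ β₂≡s) = ⊥-elim (collide β₁≡s β₂≡s)
    orient (inj₁ β₁≡s) (inj₂ β₂≡t) = inj₁ (≡ₘ-trans φ₁ (+-congˡₘ (φ u) β₁≡s) , ≡ₘ-trans φ₂ (+-congˡₘ (φ u) β₂≡t))
    orient (inj₂ β₁≡t) (inj₁ β₂≡s) = inj₂ (≡ₘ-trans φ₁ (+-congˡₘ (φ u) β₁≡t) , ≡ₘ-trans φ₂ (+-congˡₘ (φ u) β₂≡s))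
    orient (inj₂ β₁≡t) (inj₂ β₂≡t) = ⊥-elim (collide β₁≡t β₂≡t)

  module Propagation (s′ t′ : ℤ) (step-s′ : IsStep s′) (step-t′ : IsStep t′) (s′≢t′ : ¬ s′ ≡ t′ [mod N ])
    (oriented′ : ∀ u → Oriented s′ t′ u ⊎ Oriented t′ s′ u) where

    -- φ u + s′ + t′ is an out-neighbour of both u + e₁ and u + e₂; only u + e₁ + e₂ is a common one.
    diamond : ∀ u → Oriented s′ t′ u → φ ((u +² e₁) +² e₂) ≡ φ u + s′ + t′ [mod N ]
    diamond u (φ₁ , φ₂) = ≡ₘ-sym (common (successor (u +² e₁) step-t′ via-e₁) (successor (u +² e₂) step-s′ via-e₂))
      where
      l : ∀ x a b → x + a + b ≡ x + b + a
      l = solve-∀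
      via-e₁ : φ u + s′ + t′ ≡ φ (u +² e₁) + t′ [mod N ]
      via-e₁ = +-congʳₘ t′ (≡ₘ-sym φ₁)
      via-e₂ : φ u + s′ + t′ ≡ φ (u +² e₂) + s′ [mod N ]
      via-e₂ = ≡ₘ-trans (≡⇒≡ₘ (l (φ u) s′ t′)) (+-congʳₘ s′ (≡ₘ-sym φ₂))
      common : ∀ {y} → y ≡ φ ((u +² e₁) +² e₁) [mod N ] ⊎ y ≡ φ ((u +² e₁) +² e₂) [mod N ] →
               y ≡ φ ((u +² e₂) +² e₁) [mod N ] ⊎ y ≡ φ ((u +² e₂) +² e₂) [mod N ] →
               y ≡ φ ((u +² e₁) +² e₂) [mod N ]
      common (inj₂ y≡) _ = y≡
      common (inj₁ y≡) (inj₁ y≡′) = ⊥-elim (2e₁≢e₂+e₁ u (φ-injective (≡ₘ-trans (≡ₘ-sym y≡) y≡′)))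
      common (inj₁ y≡) (inj₂ y≡′) = ⊥-elim (2e₁≢2e₂ u (φ-injective (≡ₘ-trans (≡ₘ-sym y≡) y≡′)))

    forward : ∀ u → Oriented s′ t′ u → Oriented s′ t′ (u +² e₁) × Oriented s′ t′ (u +² e₂)
    forward u o@(φ₁ , φ₂) = [ id , flipped₁ ]′ (oriented′ (u +² e₁)) , [ id , flipped₂ ]′ (oriented′ (u +² e₂))
      where
      l : ∀ x a b → x + a + b ≡ x + b + a
      l = solve-∀
      flipped₁ : Oriented t′ s′ (u +² e₁) → Oriented s′ t′ (u +² e₁)
      flipped₁ (_ , ψ₂) = ⊥-elim (s′≢t′ (≡ₘ-sym (+-cancelˡₘ (φ u + s′)
        (≡ₘ-trans (≡ₘ-sym (diamond u o)) (≡ₘ-trans ψ₂ (+-congʳₘ s′ φ₁))))))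
      flipped₂ : Oriented t′ s′ (u +² e₂) → Oriented s′ t′ (u +² e₂)
      flipped₂ (ψ₁ , _) = ⊥-elim (s′≢t′ (+-cancelˡₘ (φ u + t′)
        (≡ₘ-trans (≡⇒≡ₘ (l (φ u) t′ s′)) (≡ₘ-trans (≡ₘ-sym (diamond u o))
          (≡ₘ-trans (φ-cong (≡²-sym (e₂+e₁≡e₁+e₂ u))) (≡ₘ-trans ψ₁ (+-congʳₘ t′ φ₂)))))))

  forward-st : ∀ u → Oriented s t u → Oriented s t (u +² e₁) × Oriented s t (u +² e₂)
  forward-st = Propagation.forward s t step-s step-t s≢t oriented

  forward-ts : ∀ u → Oriented t s u → Oriented t s (u +² e₁) × Oriented t s (u +² e₂)
  forward-ts = Propagation.forward t s step-t step-s (λ t≡s → s≢t (≡ₘ-sym t≡s)) (λ u → Sum.swap (oriented u))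

  not-both : ∀ {u} → Oriented s t u → Oriented t s u → ⊥
  not-both {u} (φ₁ , _) (φ₁′ , _) = s≢t (+-cancelˡₘ (φ u) (≡ₘ-trans (≡ₘ-sym φ₁) φ₁′))

  oriented-everywhere : ∀ u → Oriented s t u
  oriented-everywhere = ℤ²-induction (Oriented s t) (≡⇒≡ₘ (l (φ e₁) (φ o)) , ≡⇒≡ₘ (l (φ e₂) (φ o)))
    (λ u → mk⇔ (λ o → proj₁ (forward-st u o)) (λ o₁ → [ (λ o → o) , (λ o′ → ⊥-elim (not-both o₁ (proj₁ (forward-ts u o′)))) ]′ (oriented u)))
    (λ u → mk⇔ (λ o → proj₂ (forward-st u o)) (λ o₂ → [ (λ o → o) , (λ o′ → ⊥-elim (not-both o₂ (proj₂ (forward-ts u o′)))) ]′ (oriented u)))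
    where
    l : ∀ a b → a ≡ b + (a - b)
    l = solve-∀

  φ-affine : ∀ u → φ u ≡ φ o + proj₁ u * s + proj₂ u * t [mod N ]
  φ-affine = ℤ²-induction (λ u → φ u ≡ φ o + proj₁ u * s + proj₂ u * t [mod N ]) (≡⇒≡ₘ (l₀ (φ o) s t))
    (λ u → step (proj₁ (oriented-everywhere u)) (l₁ (φ o) (proj₁ u) (proj₂ u) s t))
    (λ u → step (proj₂ (oriented-everywhere u)) (l₂ (φ o) (proj₁ u) (proj₂ u) s t))
    where
    l₀ : ∀ x s t → x ≡ x + 0ℤ * s + 0ℤ * t
    l₀ = solve-∀
    l₁ : ∀ x a b s t → x + a * s + b * t + s ≡ x + (a + 1ℤ) * s + (b + 0ℤ) * t
    l₁ = solve-∀
    l₂ : ∀ x a b s t → x + a * s + b * t + t ≡ x + (a + 0ℤ) * s + (b + 1ℤ) * t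
    l₂ = solve-∀
    step : ∀ {x y β X Y} → y ≡ x + β [mod N ] → X + β ≡ Y → x ≡ X [mod N ] ⇔ y ≡ Y [mod N ]
    step {β = β} y≡ refl = mk⇔ (λ x≡ → ≡ₘ-trans y≡ (+-congʳₘ β x≡))
                               (λ y≡Y → +-cancelʳₘ β (≡ₘ-trans (≡ₘ-sym y≡) y≡Y))

  [t,-s]∈Λ : (t , - s) ∈Λ M
  [t,-s]∈Λ = ≡²0⇒∈Λ (φ-injective (≡ₘ-trans (φ-affine (t , - s)) (≡⇒≡ₘ (l (φ o) s t))))
    where
    l : ∀ x s t → x + t * s + - s * t ≡ x
    l = solve-∀

  [n,0]∈Λ : (N , 0ℤ) ∈Λ M
  [n,0]∈Λ = ≡²0⇒∈Λ (φ-injective (≡ₘ-trans (φ-affine (N , 0ℤ)) (mod (divides s (l (φ o) s t N)))))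
    where
    l : ∀ x s t N → (x + N * s + 0ℤ * t) - x ≡ s * N
    l = solve-∀

  -- Surjectivity of φ: some w has φ w = φ o + 1.
  unit : ∃[ a ] ∃[ b ] (a * s + b * t ≡ 1ℤ [mod N ])
  unit = proj₁ w , proj₂ w , +-cancelˡₘ (φ o) (≡ₘ-trans (≡⇒≡ₘ (l (φ o) (proj₁ w * s) (proj₂ w * t)))
           (≡ₘ-trans (≡ₘ-sym (φ-affine w)) (φ∘ψ (φ o + 1ℤ))))
    where
    w : ℤ²
    w = ψ (φ o + 1ℤ)
    l : ∀ x a b → x + (a + b) ≡ x + a + b
    l = solve-∀

  d₁≡1 : d₁ M ≡ 1
  d₁≡1 = ℕD.∣1⇒≡1 (ℤ∣.∣⇒∣ᵤ (subst (d ∣_) (l (a * s + b * t)) (ℤ∣.∣m∣n⇒∣m-n d∣as+bt d∣as+bt-1)))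
    where
    d : ℤ
    d = + d₁ M
    a b : ℤ
    a = proj₁ unit
    b = proj₁ (proj₂ unit)
    d∣t : d ∣ t
    d∣t = proj₁ (Λ⇒d₁∣ [t,-s]∈Λ)
    d∣s : d ∣ s
    d∣s = subst (d ∣_) (ℤP.neg-involutive s) (ℤ∣.∣m⇒∣-m (proj₂ (Λ⇒d₁∣ [t,-s]∈Λ)))
    d∣as+bt : d ∣ a * s + b * t
    d∣as+bt = ℤ∣.∣m∣n⇒∣m+n (ℤ∣.∣n⇒∣m*n a d∣s) (ℤ∣.∣n⇒∣m*n b d∣t)
    d∣as+bt-1 : d ∣ a * s + b * t - 1ℤ
    d∣as+bt-1 = ℤ∣.∣-trans (proj₁ (Λ⇒d₁∣ [n,0]∈Λ)) (unmod (proj₂ (proj₂ unit)))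
    l : ∀ x → x - (x - 1ℤ) ≡ 1ℤ
    l = solve-∀

∣2⇒≡1∨≡2 : ∀ {k} → k ℕD.∣ 2 → k ≡ 1 ⊎ k ≡ 2
∣2⇒≡1∨≡2 {0} 0∣2 with () ← ℕD.0∣⇒≡0 0∣2
∣2⇒≡1∨≡2 {1} _ = inj₁ refl
∣2⇒≡1∨≡2 {2} _ = inj₂ refl
∣2⇒≡1∨≡2 {suc (suc (suc _))} k∣2 with ℕ.s≤s (ℕ.s≤s ()) ← ℕD.∣⇒≤ k∣2

m≡2g-arithmetic : ∀ {m g} → g ≢ 0 → g ℕD.∣ m → m ℕD.∣ 2 ℕ.* g → m ≢ g → m ≡ 2 ℕ.* g
m≡2g-arithmetic {g = g} g≢0 (ℕD.divides k refl) kg∣2g kg≢g =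
  [ (λ { refl → ⊥-elim (kg≢g (ℕP.*-identityˡ g)) }) , (λ { refl → refl }) ]′
  (∣2⇒≡1∨≡2 (ℕD.*-cancelʳ-∣ {k} {2} g {{ℕ.≢-nonZero g≢0}} kg∣2g))

module _ {M : Mat2} where

  private
    m : ℕ
    m = ∣ det M ∣
    P Q : ℤ
    P = m11 M + m21 M
    Q = m22 M + m12 M
    g : ℕ
    g = gcd (gcd m ∣ Q ∣) ∣ P ∣

  [2,-2]∈Λ⇒m∣2g : (+ 2 , - + 2) ∈Λ M → m ℕD.∣ 2 ℕ.* g
  [2,-2]∈Λ⇒m∣2g [2,-2]∈Λ = subst (m ℕD.∣_) 2g≡ (gcd-greatest (gcd-greatest (ℕD.n∣m*n 2) m∣2Q) m∣2P)
    where
    lQ : ∀ a b → + 2 * (a + b) ≡ a * + 2 - b * - + 2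
    lQ = solve-∀
    lP : ∀ a b → + 2 * (- (a + b)) ≡ a * - + 2 - b * + 2
    lP = solve-∀
    m∣2Q : m ℕD.∣ 2 ℕ.* ∣ Q ∣
    m∣2Q = subst (m ℕD.∣_) (ℤP.abs-* (+ 2) Q)
             (ℤ∣.∣⇒∣ᵤ (subst (det M ∣_) (sym (lQ (m22 M) (m12 M))) (proj₁ (Λ⇒det∣adj [2,-2]∈Λ))))
    m∣2P : m ℕD.∣ 2 ℕ.* ∣ P ∣
    m∣2P = subst (m ℕD.∣_) (trans (ℤP.abs-* (+ 2) (- P)) (cong (2 ℕ.*_) (ℤP.∣-i∣≡∣i∣ P)))
             (ℤ∣.∣⇒∣ᵤ (subst (det M ∣_) (sym (lP (m11 M) (m21 M))) (proj₂ (Λ⇒det∣adj [2,-2]∈Λ))))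
    2g≡ : gcd (gcd (2 ℕ.* m) (2 ℕ.* ∣ Q ∣)) (2 ℕ.* ∣ P ∣) ≡ 2 ℕ.* g
    2g≡ = sym (trans (c*gcd[m,n]≡gcd[cm,cn] 2 (gcd m ∣ Q ∣) ∣ P ∣)
                     (cong (λ x → gcd x (2 ℕ.* ∣ P ∣)) (c*gcd[m,n]≡gcd[cm,cn] 2 m ∣ Q ∣)))

  m≡g⇒[1,-1]∈Λ : det M ≢ 0ℤ → m ≡ g → (1ℤ , - 1ℤ) ∈Λ M
  m≡g⇒[1,-1]∈Λ D≢0 m≡g = det∣adj⇒Λ D≢0
    ( subst (det M ∣_) (sym (l₁ (m22 M) (m12 M))) (ℤ∣.∣ᵤ⇒∣ m∣Q)
    , subst (det M ∣_) (sym (l₂ (m11 M) (m21 M))) (ℤ∣.∣m⇒∣-m (ℤ∣.∣ᵤ⇒∣ m∣P)))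
    where
    l₁ : ∀ a b → a * + 1 - b * - + 1 ≡ a + b
    l₁ = solve-∀
    l₂ : ∀ a b → a * - + 1 - b * + 1 ≡ - (a + b)
    l₂ = solve-∀
    m∣Q : m ℕD.∣ ∣ Q ∣
    m∣Q = subst (ℕD._∣ ∣ Q ∣) (sym m≡g) (ℕD.∣-trans (gcd[m,n]∣m (gcd m ∣ Q ∣) ∣ P ∣) (gcd[m,n]∣n m ∣ Q ∣))
    m∣P : m ℕD.∣ ∣ P ∣
    m∣P = subst (ℕD._∣ ∣ P ∣) (sym m≡g) (gcd[m,n]∣n (gcd m ∣ Q ∣) ∣ P ∣)

  [2,-2]∈Λ⇒m≡2g : det M ≢ 0ℤ → (+ 2 , - + 2) ∈Λ M → ¬ (1ℤ , - 1ℤ) ∈Λ M → m ≡ 2 ℕ.* g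
  [2,-2]∈Λ⇒m≡2g D≢0 [2,-2]∈Λ [1,-1]∉Λ =
    m≡2g-arithmetic g≢0 (ℕD.∣-trans (gcd[m,n]∣m _ _) (gcd[m,n]∣m _ _)) ([2,-2]∈Λ⇒m∣2g [2,-2]∈Λ)
      (λ m≡g → [1,-1]∉Λ (m≡g⇒[1,-1]∈Λ D≢0 m≡g))
    where
    g≢0 : g ≢ 0
    g≢0 g≡0 = D≢0 (ℤP.∣i∣≡0⇒i≡0 (gcd[m,n]≡0⇒m≡0 (gcd[m,n]≡0⇒m≡0 g≡0)))

circulant⇒d₁-condition : ∀ M → det M ≢ 0ℤ → IsCirculant G⟨ M ,e₁,e₂⟩ →
  d₁ M ≡ 1 ⊎ (d₁ M ≡ 2 × ∣ det M ∣ ≡ 2 ℕ.* gcd (gcd ∣ det M ∣ ∣ m22 M + m12 M ∣) ∣ m11 M + m21 M ∣)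
circulant⇒d₁-condition M D≢0 (_ , _ , _ , iso) with Λ? {M} D≢0 (1ℤ , - 1ℤ) | Λ? {M} D≢0 (+ 2 , - + 2)
... | yes [1,-1]∈Λ | _ = inj₁ (ℕD.∣1⇒≡1 (ℤ∣.∣⇒∣ᵤ (proj₁ (Λ⇒d₁∣ [1,-1]∈Λ))))
... | no [1,-1]∉Λ | no [2,-2]∉Λ = inj₁ (CirculantLabelling.d₁≡1 iso [1,-1]∉Λ [2,-2]∉Λ)
... | no [1,-1]∉Λ | yes [2,-2]∈Λ =
  Sum.map₂ (λ d₁≡2 → d₁≡2 , [2,-2]∈Λ⇒m≡2g {M} D≢0 [2,-2]∈Λ [1,-1]∉Λ) (∣2⇒≡1∨≡2 (ℤ∣.∣⇒∣ᵤ (proj₁ (Λ⇒d₁∣ [2,-2]∈Λ))))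

d₁≡1⇒circulant : ∀ M → det M ≢ 0ℤ → d₁ M ≡ 1 → IsCirculant G⟨ M ,e₁,e₂⟩
d₁≡1⇒circulant M D≢0 d₁≡1 =
  let _ , _ , hx∈Λ , x⊥h = d₁≡1⇒primitive-vector M D≢0 d₁≡1 in primitive-vector⇒circulant D≢0 hx∈Λ x⊥h

corollary3p6 : (M : Mat2) → det M ≢ 0ℤ → (m : ℕ) → ∣ det M ∣ ≡ m →
    IsCirculant G⟨ M ,e₁,e₂⟩ ⇔
      (d₁ M ≡ 1 ⊎ (d₁ M ≡ 2 × m ≡ 2 ℕ.* gcd (gcd m ∣ m22 M + m12 M ∣) ∣ m11 M + m21 M ∣))
corollary3p6 M D≢0 _ refl = mk⇔ (circulant⇒d₁-condition M D≢0)
  [ d₁≡1⇒circulant M D≢0 , (λ (_ , m≡2g) → m≡2g⇒circulant M D≢0 m≡2g) ]′
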